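{- Let $A=(a_{ij})$ be an $n\times n$ Ferrers matrix with $a_{nn}=0$, let $k\ge 1$ be the number of $0$'s in the last column of $A$, and let $A^\circ$ be the $(n-1)\times(n-1)$ matrix obtained from $A$ by deleting its last row and last column. Then $$\mathrm{per}(B(A))=k\,x_n\,\mathrm{per}(B(A^\circ))+x_ny_n\,\partial\,\mathrm{per}(B(A^\circ)),\qquad \partial=\sum_{i=1}^{n-k}\frac{\partial}{\partial x_i}+\sum_{j=1}^{n-1}\frac{\partial}{\partial y_j}.$$
   Context: A Ferrers matrix is a $\{0,1\}$-matrix whose entries are weakly decreasing down each column and weakly increasing across each row. For an $m\times m$ Ferrers matrix $A$, $B(A)=(b_{ij})$ is the $m\times m$ matrix with $b_{ij}=a_{ij}y_j+(1-a_{ij})x_i$, where $x_1,\dots,x_m,y_1,\dots,y_m$ are indeterminates (so $B(A^\circ)$ involves $x_1,\dots,x_{n-1},y_1,\dots,y_{n-1}$). $\mathrm{per}(H)=\sum_{\sigma\in S_m}\prod_i h_{i,\sigma(i)}$, with the permanent of the empty matrix equal to $1$. -}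

module Defs where

open import Data.Nat as ℕ using (ℕ; zero; suc; pred)
open import Data.Integer as ℤ using (ℤ; +_)
open import Data.Bool as Bool using (Bool; true; false; _∧_; _∨_; not; if_then_else_)
open import Data.Fin as Fin using (Fin; toℕ; fromℕ; inject₁)
open import Data.Fin.Properties as FinP using ()
open import Data.Vec as Vec using (Vec; []; _∷_; lookup; replicate; zipWith; _[_]%=_; tabulate)
open import Data.Vec.Properties using (≡-dec)
open import Data.List as List using (List; []; _∷_; [_]; map; concatMap; filter; foldr; allFin; _++_)
open import Data.Product using (_×_; _,_; proj₁; proj₂)
open import Relation.Nullary.Decidable using (⌊_⌋; _×-dec_)
open import Relation.Binary.PropositionalEquality using (_≡_)

-- Polynomials with integer coefficients in the 2N commuting
-- indeterminates x_0..x_{N-1}, y_0..y_{N-1} (0-indexed).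
-- A monomial is a pair of exponent vectors (for the x's and the y's).
-- A polynomial is a finite formal sum (list) of coefficient-monomial
-- terms; two polynomials are equal iff all their coefficients agree.

Mono : ℕ → Set
Mono N = Vec ℕ N × Vec ℕ N

Poly : ℕ → Set
Poly N = List (ℤ × Mono N)

_≟M_ : ∀ {N} (m m' : Mono N) → Relation.Nullary.Decidable.Dec (m ≡ m')
(a , b) ≟M (a' , b') with ≡-dec ℕ._≟_ a a' | ≡-dec ℕ._≟_ b b'
... | Relation.Nullary.Decidable.yes Relation.Binary.PropositionalEquality.refl
    | Relation.Nullary.Decidable.yes Relation.Binary.PropositionalEquality.refl
    = Relation.Nullary.Decidable.yes Relation.Binary.PropositionalEquality.refl
... | Relation.Nullary.Decidable.no ¬p | _ = Relation.Nullary.Decidable.no λ { Relation.Binary.PropositionalEquality.refl → ¬p Relation.Binary.PropositionalEquality.refl }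
... | Relation.Nullary.Decidable.yes _ | Relation.Nullary.Decidable.no ¬q = Relation.Nullary.Decidable.no λ { Relation.Binary.PropositionalEquality.refl → ¬q Relation.Binary.PropositionalEquality.refl }

coeff : ∀ {N} → Poly N → Mono N → ℤ
coeff []             m = + 0
coeff ((c , m') ∷ p) m = (if ⌊ m' ≟M m ⌋ then c else + 0) ℤ.+ coeff p m

infix 4 _≈P_
_≈P_ : ∀ {N} → Poly N → Poly N → Set
p ≈P q = ∀ m → coeff p m ≡ coeff q m

unitMono : ∀ {N} → Mono N
unitMono = replicate _ 0 , replicate _ 0

constP : ∀ {N} → ℤ → Poly N
constP c = [ (c , unitMono) ]

oneP : ∀ {N} → Poly N
oneP = constP (+ 1)

zeroP : ∀ {N} → Poly N
zeroP = []

δ : ∀ {N} → Fin N → Vec ℕ N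
δ i = tabulate λ j → if ⌊ j Fin.≟ i ⌋ then 1 else 0

xv : ∀ {N} → Fin N → Poly N
xv i = [ (+ 1 , (δ i , replicate _ 0)) ]

yv : ∀ {N} → Fin N → Poly N
yv i = [ (+ 1 , (replicate _ 0 , δ i)) ]

infixl 6 _+P_
infixl 7 _*P_

_+P_ : ∀ {N} → Poly N → Poly N → Poly N
p +P q = p ++ q

mulMono : ∀ {N} → Mono N → Mono N → Mono N
mulMono (a , b) (a' , b') = zipWith ℕ._+_ a a' , zipWith ℕ._+_ b b'

_*P_ : ∀ {N} → Poly N → Poly N → Poly N
p *P q = concatMap (λ t → map (λ s → (proj₁ t ℤ.* proj₁ s , mulMono (proj₂ t) (proj₂ s))) q) p

∂x : ∀ {N} → Fin N → Poly N → Poly N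
∂x i = map λ { (c , (a , b)) → (c ℤ.* + lookup a i , (a [ i ]%= pred , b)) }

∂y : ∀ {N} → Fin N → Poly N → Poly N
∂y j = map λ { (c , (a , b)) → (c ℤ.* + lookup b j , (a , b [ j ]%= pred)) }

sumP : ∀ {N} → List (Poly N) → Poly N
sumP = foldr _+P_ zeroP

prodP : ∀ {N} → List (Poly N) → Poly N
prodP = foldr _*P_ oneP

-- Permutations of Fin m: injective maps Fin m → Fin m, encoded as
-- vectors of images; allMaps m m enumerates every map Fin m → Fin m once.

allMaps : (k m : ℕ) → List (Vec (Fin m) k)
allMaps zero    m = [ [] ]
allMaps (suc k) m = concatMap (λ f → map (f ∷_) (allMaps k m)) (allFin m)

allB : ∀ {a} {X : Set a} → (X → Bool) → List X → Bool
allB p = foldr (λ x r → p x ∧ r) true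

isInjective : ∀ {k m} → Vec (Fin m) k → Bool
isInjective {k} v =
  allB (λ i → allB (λ j → ⌊ i Fin.≟ j ⌋ ∨ not ⌊ lookup v i Fin.≟ lookup v j ⌋) (allFin k)) (allFin k)

perms : (m : ℕ) → List (Vec (Fin m) m)
perms m = filter (λ v → Relation.Nullary.Decidable.T? (isInjective v)) (allMaps m m)

per : ∀ {m N} → (Fin m → Fin m → Poly N) → Poly N
per {m} H = sumP (map (λ σ → prodP (map (λ i → H i (lookup σ i)) (allFin m))) (perms m))

-- Ferrers matrices ({0,1}-matrices, 1 = true, 0 = false)

IsFerrers : ∀ {m} → (Fin m → Fin m → Bool) → Set
IsFerrers {m} A =
  (∀ i i' j → i Fin.≤ i' → A i' j Bool.≤ A i j)
  × (∀ i j j' → j Fin.≤ j' → A i j Bool.≤ A i j')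

-- B(A) with b_ij = a_ij y_j + (1 - a_ij) x_i, where the row/column
-- indices of A are sent to variable indices by emb
-- (emb = id for A itself, emb = inject₁ for A° inside the n-variable ring).
B : ∀ {m N} → (Fin m → Fin N) → (Fin m → Fin m → Bool) → Fin m → Fin m → Poly N
B emb A i j = if A i j then yv (emb j) else xv (emb i)

zerosInColumn : ∀ {m} → (Fin m → Fin m → Bool) → Fin m → ℕ
zerosInColumn {m} A j = List.length (filter (λ i → Relation.Nullary.Decidable.T? (not (A i j))) (allFin m))

deleteLast : ∀ {m} → (Fin (suc m) → Fin (suc m) → Bool) → Fin m → Fin m → Bool
deleteLast A i j = A (inject₁ i) (inject₁ j)

-- ∂ = Σ_{i=1}^{n-k} ∂/∂x_i + Σ_{j=1}^{n-1} ∂/∂y_j   (1-indexed as in the paper;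
-- here indices are 0-indexed so i ranges over toℕ i < n - k, j over toℕ j < n - 1)
∂op : (n k : ℕ) → Poly n → Poly n
∂op n k p =
  sumP (map (λ i → ∂x i p) (filter (λ i → toℕ i ℕ.<? (n ℕ.∸ k)) (allFin n)))
  +P sumP (map (λ j → ∂y j p) (filter (λ j → toℕ j ℕ.<? (n ℕ.∸ 1)) (allFin n)))

module Submission where

-- For the theorem (module Expansion): the last row of B(A) is constantly x_n
-- (rows of A increase and a_nn = 0).  Expanding the other rows along the last
-- column, a row i with a_in = 0 is constantly x_i in B(A°) and contributes
-- per B(A°), which happens k - 1 times; a row with a_in = 1 contributes y_n Q_i,
-- where Q_i is per B(A°) with row i replaced by ones.  Finally ∂ acts on
-- row i of B(A°) as the constant a_in (columns of A decrease, so a_in = 1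
-- exactly for i ≤ n - k), whence ∂ per B(A°) = Σ_{a_in = 1} Q_i.

open import Defs
open import Data.Nat as ℕ using (ℕ; zero; suc; pred; _≤_)
import Data.Nat.Properties as ℕP
open import Data.Integer as ℤ using (ℤ; +_)
import Data.Integer.Properties as ℤP
open import Data.Integer.Solver using (module +-*-Solver)
open import Data.Bool as Bool using (Bool; true; false; _∧_; _∨_; not; if_then_else_; T)
import Data.Bool.Properties as BoolP
open import Data.Unit using (tt)
open import Data.Empty using (⊥; ⊥-elim)
open import Data.Fin as Fin using (Fin; toℕ; fromℕ; inject₁; punchIn)
import Data.Fin.Properties as FinP
open import Data.Vec using (Vec; []; _∷_; lookup; replicate; zipWith; _[_]%=_)
import Data.Vec.Properties as VecP
open import Data.List as List using (List; []; _∷_; [_]; map; concatMap; filter; allFin; length; _++_)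
import Data.List.Properties as ListP
open import Data.Product using (_×_; _,_; proj₁; proj₂)
open import Relation.Nullary.Decidable using (⌊_⌋; yes; no; Dec; does; T?)
open import Relation.Binary.PropositionalEquality using (_≡_; refl; sym; trans; cong; cong₂; subst; module ≡-Reasoning)
open import Function using (id; _∘_)
import Algebra.Properties.CommutativeSemigroup as CommSemigroupProps
open import Algebra.Bundles using (CommutativeSemiring)
open import Algebra.Structures.Biased using (IsCommutativeSemiringˡ; IsCommutativeMonoidˡ)
import Relation.Binary.Reasoning.Setoid as SetoidReasoning
open import Algebra.Structures using (IsMagma)
import Algebra.Properties.Semiring.Sum as SumProps
import Algebra.Properties.Semiring.Mult as MultProps
import Data.Vec.Functional as VecF
import Data.Vec.Functional.Properties as VecFP
open import Function.Definitions using (Injective)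
open import Function.Bundles using (Equivalence)

sumℤ : ∀ {a} {A : Set a} → (A → ℤ) → List A → ℤ
sumℤ f []       = + 0
sumℤ f (x ∷ xs) = f x ℤ.+ sumℤ f xs

module _ {a} {A : Set a} where

  sumℤ-++ : (f : A → ℤ) (xs ys : List A) → sumℤ f (xs ++ ys) ≡ sumℤ f xs ℤ.+ sumℤ f ys
  sumℤ-++ f []       ys = sym (ℤP.+-identityˡ _)
  sumℤ-++ f (x ∷ xs) ys = trans (cong (ℤ._+_ (f x)) (sumℤ-++ f xs ys)) (sym (ℤP.+-assoc (f x) _ _))

  sumℤ-cong : {f g : A → ℤ} → (∀ x → f x ≡ g x) → (xs : List A) → sumℤ f xs ≡ sumℤ g xs
  sumℤ-cong e []       = refl
  sumℤ-cong e (x ∷ xs) = cong₂ ℤ._+_ (e x) (sumℤ-cong e xs)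

  sumℤ-+ : (f g : A → ℤ) (xs : List A) → sumℤ (λ x → f x ℤ.+ g x) xs ≡ sumℤ f xs ℤ.+ sumℤ g xs
  sumℤ-+ f g []       = refl
  sumℤ-+ f g (x ∷ xs) = trans (cong (ℤ._+_ (f x ℤ.+ g x)) (sumℤ-+ f g xs))
                              (CommSemigroupProps.interchange ℤP.+-commutativeSemigroup (f x) (g x) _ _)

  sumℤ-*ˡ : (c : ℤ) (f : A → ℤ) (xs : List A) → sumℤ (λ x → c ℤ.* f x) xs ≡ c ℤ.* sumℤ f xs
  sumℤ-*ˡ c f []       = sym (ℤP.*-zeroʳ c)
  sumℤ-*ˡ c f (x ∷ xs) = trans (cong (ℤ._+_ (c ℤ.* f x)) (sumℤ-*ˡ c f xs)) (sym (ℤP.*-distribˡ-+ c (f x) _))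

  sumℤ-zero : (xs : List A) → sumℤ (λ _ → + 0) xs ≡ + 0
  sumℤ-zero []       = refl
  sumℤ-zero (x ∷ xs) = trans (ℤP.+-identityˡ _) (sumℤ-zero xs)

module _ {a b} {A : Set a} {B : Set b} where

  sumℤ-swap : (g : A → B → ℤ) (xs : List A) (ys : List B) →
    sumℤ (λ x → sumℤ (g x) ys) xs ≡ sumℤ (λ y → sumℤ (λ x → g x y) xs) ys
  sumℤ-swap g []       ys = sym (sumℤ-zero ys)
  sumℤ-swap g (x ∷ xs) ys = trans (cong (ℤ._+_ (sumℤ (g x) ys)) (sumℤ-swap g xs ys))
                                  (sym (sumℤ-+ (g x) (λ y → sumℤ (λ x → g x y) xs) ys))

  sumℤ-map : (f : B → ℤ) (g : A → B) (xs : List A) → sumℤ f (map g xs) ≡ sumℤ (f ∘ g) xs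
  sumℤ-map f g []       = refl
  sumℤ-map f g (x ∷ xs) = cong (ℤ._+_ (f (g x))) (sumℤ-map f g xs)

  sumℤ-concatMap : (f : B → ℤ) (g : A → List B) (xs : List A) →
    sumℤ f (concatMap g xs) ≡ sumℤ (λ x → sumℤ f (g x)) xs
  sumℤ-concatMap f g []       = refl
  sumℤ-concatMap f g (x ∷ xs) = trans (sumℤ-++ f (g x) (concatMap g xs))
                                      (cong (ℤ._+_ (sumℤ f (g x))) (sumℤ-concatMap f g xs))

isYes-true : ∀ {p} {P : Set p} (d : Dec P) → P → ⌊ d ⌋ ≡ true
isYes-true (yes _) _ = refl
isYes-true (no ¬p) p = ⊥-elim (¬p p)

isYes-false : ∀ {p} {P : Set p} (d : Dec P) → (P → ⊥) → ⌊ d ⌋ ≡ false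
isYes-false (yes p) ¬p = ⊥-elim (¬p p)
isYes-false (no _)  _  = refl

-- Monomials form a cancellative commutative monoid under mulMono (addition
-- of exponent vectors).  The quotient m ÷ u subtracts exponents; it is the
-- only candidate v with u · v = m.

infixl 30 _÷_
_÷_ : ∀ {N} → Mono N → Mono N → Mono N
(a , b) ÷ (a' , b') = zipWith ℕ._∸_ a a' , zipWith ℕ._∸_ b b'

module _ {N : ℕ} where

  mulMono-comm : (u v : Mono N) → mulMono u v ≡ mulMono v u
  mulMono-comm (a , b) (a' , b') =
    cong₂ _,_ (VecP.zipWith-comm ℕP.+-comm a a') (VecP.zipWith-comm ℕP.+-comm b b')

  mulMono-assoc : (u v w : Mono N) → mulMono (mulMono u v) w ≡ mulMono u (mulMono v w)
  mulMono-assoc (a , b) (a' , b') (a'' , b'') =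
    cong₂ _,_ (VecP.zipWith-assoc ℕP.+-assoc a a' a'') (VecP.zipWith-assoc ℕP.+-assoc b b' b'')

  mulMono-identityˡ : (u : Mono N) → mulMono unitMono u ≡ u
  mulMono-identityˡ (a , b) =
    cong₂ _,_ (VecP.zipWith-identityˡ ℕP.+-identityˡ a) (VecP.zipWith-identityˡ ℕP.+-identityˡ b)

  quotient-unique : (u v : Mono N) → mulMono u v ÷ u ≡ v
  quotient-unique (a , b) (a' , b') = cong₂ _,_ (go a a') (go b b')
    where
    go : ∀ {n} (x y : Vec ℕ n) → zipWith ℕ._∸_ (zipWith ℕ._+_ x y) x ≡ y
    go []       []       = refl
    go (x ∷ xs) (y ∷ ys) = cong₂ _∷_ (ℕP.m+n∸m≡n x y) (go xs ys)

termCoeff : ∀ {N} → ℤ × Mono N → Mono N → ℤ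
termCoeff t m = if ⌊ proj₂ t ≟M m ⌋ then proj₁ t else + 0

_⊗_ : ∀ {N} → ℤ × Mono N → ℤ × Mono N → ℤ × Mono N
t ⊗ s = (proj₁ t ℤ.* proj₁ s , mulMono (proj₂ t) (proj₂ s))

module _ {N : ℕ} where

  coeff-sum : (p : Poly N) (m : Mono N) → coeff p m ≡ sumℤ (λ t → termCoeff t m) p
  coeff-sum []      m = refl
  coeff-sum (t ∷ p) m = cong (ℤ._+_ (termCoeff t m)) (coeff-sum p m)

  coeff-++ : (p q : Poly N) (m : Mono N) → coeff (p ++ q) m ≡ coeff p m ℤ.+ coeff q m
  coeff-++ p q m = begin
    coeff (p ++ q) m                                           ≡⟨ coeff-sum (p ++ q) m ⟩
    sumℤ (λ t → termCoeff t m) (p ++ q)                         ≡⟨ sumℤ-++ _ p q ⟩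
    sumℤ (λ t → termCoeff t m) p ℤ.+ sumℤ (λ t → termCoeff t m) q ≡⟨ cong₂ ℤ._+_ (coeff-sum p m) (coeff-sum q m) ⟨
    coeff p m ℤ.+ coeff q m                                    ∎
    where open ≡-Reasoning

  coeff-* : (p q : Poly N) (m : Mono N) →
    coeff (p *P q) m ≡ sumℤ (λ t → sumℤ (λ s → termCoeff (t ⊗ s) m) q) p
  coeff-* p q m = begin
    coeff (p *P q) m                                        ≡⟨ coeff-sum (p *P q) m ⟩
    sumℤ (λ w → termCoeff w m) (p *P q)                      ≡⟨ sumℤ-concatMap _ _ p ⟩
    sumℤ (λ t → sumℤ (λ w → termCoeff w m) (map (t ⊗_) q)) p ≡⟨ sumℤ-cong (λ t → sumℤ-map _ (t ⊗_) q) p ⟩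
    sumℤ (λ t → sumℤ (λ s → termCoeff (t ⊗ s) m) q) p        ∎
    where open ≡-Reasoning

  termCoeff-mulMono : (c : ℤ) (u v m : Mono N) →
    termCoeff (c , mulMono u v) m
      ≡ (if ⌊ mulMono u (m ÷ u) ≟M m ⌋ then termCoeff (c , v) (m ÷ u) else + 0)
  termCoeff-mulMono c u v m with mulMono u v ≟M m
  ... | yes refl = exact (mulMono u v ÷ u) (quotient-unique u v)
    where
    exact : ∀ w → w ≡ v →
      c ≡ (if ⌊ mulMono u w ≟M mulMono u v ⌋ then (if ⌊ v ≟M w ⌋ then c else + 0) else + 0)
    exact w refl rewrite isYes-true (mulMono u w ≟M mulMono u w) refl | isYes-true (w ≟M w) refl = refl
  ... | no uv≢m with mulMono u (m ÷ u) ≟M m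
  ...   | no _     = refl
  ...   | yes u[m÷u]≡m = sym (cong (λ b → if b then c else + 0)
                               (isYes-false (v ≟M m ÷ u) (λ { refl → uv≢m u[m÷u]≡m })))

  sum-termCoeff-⊗ : (c : ℤ) (u : Mono N) (q : Poly N) (m : Mono N) →
    sumℤ (λ s → termCoeff ((c , u) ⊗ s) m) q
      ≡ c ℤ.* (if ⌊ mulMono u (m ÷ u) ≟M m ⌋ then coeff q (m ÷ u) else + 0)
  sum-termCoeff-⊗ c u q m =
    trans (sumℤ-cong (λ s → termCoeff-mulMono _ u (proj₂ s) m) q) (by-divisibility ⌊ mulMono u (m ÷ u) ≟M m ⌋)
    where
    open ≡-Reasoning
    quot : ℤ × Mono N → ℤ
    quot s = termCoeff (c ℤ.* proj₁ s , proj₂ s) (m ÷ u)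
    pull : ∀ d v → termCoeff (c ℤ.* d , v) (m ÷ u) ≡ c ℤ.* termCoeff (d , v) (m ÷ u)
    pull d v with ⌊ v ≟M m ÷ u ⌋
    ... | true  = refl
    ... | false = sym (ℤP.*-zeroʳ c)
    by-divisibility : ∀ b → sumℤ (λ s → if b then quot s else + 0) q ≡ c ℤ.* (if b then coeff q (m ÷ u) else + 0)
    by-divisibility true  = begin
      sumℤ quot q                                ≡⟨ sumℤ-cong (λ s → pull (proj₁ s) (proj₂ s)) q ⟩
      sumℤ (λ s → c ℤ.* termCoeff s (m ÷ u)) q    ≡⟨ sumℤ-*ˡ c _ q ⟩
      c ℤ.* sumℤ (λ s → termCoeff s (m ÷ u)) q    ≡⟨ cong (c ℤ.*_) (coeff-sum q (m ÷ u)) ⟨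
      c ℤ.* coeff q (m ÷ u)                      ∎
    by-divisibility false = trans (sumℤ-zero q) (sym (ℤP.*-zeroʳ c))

-- Equality of polynomials (equality of all coefficients), wrapped in a
-- record so that both sides can be inferred.

module _ {N : ℕ} where

  infix 4 _≋_
  record _≋_ (p q : Poly N) : Set where
    constructor mk≋
    field coeffEq : p ≈P q
  open _≋_ public

  ≋-refl : {p : Poly N} → p ≋ p
  ≋-refl = mk≋ λ m → refl

  ≋-sym : {p q : Poly N} → p ≋ q → q ≋ p
  ≋-sym (mk≋ e) = mk≋ λ m → sym (e m)

  ≋-trans : {p q r : Poly N} → p ≋ q → q ≋ r → p ≋ r
  ≋-trans (mk≋ e) (mk≋ f) = mk≋ λ m → trans (e m) (f m)

  ≡⇒≋ : {p q : Poly N} → p ≡ q → p ≋ q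
  ≡⇒≋ refl = ≋-refl

  +-cong : {p p' q q' : Poly N} → p ≋ p' → q ≋ q' → p +P q ≋ p' +P q'
  +-cong {p} {p'} {q} {q'} (mk≋ e) (mk≋ f) = mk≋ λ m →
    trans (coeff-++ p q m) (trans (cong₂ ℤ._+_ (e m) (f m)) (sym (coeff-++ p' q' m)))

  +-comm : (p q : Poly N) → p +P q ≋ q +P p
  +-comm p q = mk≋ λ m →
    trans (coeff-++ p q m) (trans (ℤP.+-comm (coeff p m) (coeff q m)) (sym (coeff-++ q p m)))

  +-assoc : (p q r : Poly N) → (p +P q) +P r ≋ p +P (q +P r)
  +-assoc p q r = ≡⇒≋ (ListP.++-assoc p q r)

  -- Multiplication is commutative: swap the double sum of coeff-*.
  *-comm : (p q : Poly N) → p *P q ≋ q *P p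
  *-comm p q = mk≋ λ m → begin
    coeff (p *P q) m                                          ≡⟨ coeff-* p q m ⟩
    sumℤ (λ t → sumℤ (λ s → termCoeff (t ⊗ s) m) q) p          ≡⟨ sumℤ-swap _ p q ⟩
    sumℤ (λ s → sumℤ (λ t → termCoeff (t ⊗ s) m) p) q
      ≡⟨ sumℤ-cong (λ s → sumℤ-cong (λ t → cong (λ w → termCoeff w m) (⊗-comm t s)) p) q ⟩
    sumℤ (λ s → sumℤ (λ t → termCoeff (s ⊗ t) m) p) q          ≡⟨ coeff-* q p m ⟨
    coeff (q *P p) m                                          ∎
    where
    open ≡-Reasoning
    ⊗-comm : (t s : ℤ × Mono N) → t ⊗ s ≡ s ⊗ t
    ⊗-comm (c , u) (d , v) = cong₂ _,_ (ℤP.*-comm c d) (mulMono-comm u v)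

  -- Multiplication is associative: both sides are the same triple sum.
  *-assoc : (p q r : Poly N) → (p *P q) *P r ≋ p *P (q *P r)
  *-assoc p q r = mk≋ λ m → begin
    coeff ((p *P q) *P r) m
      ≡⟨ coeff-* (p *P q) r m ⟩
    sumℤ (λ w → sumℤ (λ s → termCoeff (w ⊗ s) m) r) (p *P q)
      ≡⟨ sumℤ-concatMap _ _ p ⟩
    sumℤ (λ t → sumℤ (λ w → sumℤ (λ s → termCoeff (w ⊗ s) m) r) (map (t ⊗_) q)) p
      ≡⟨ sumℤ-cong (λ t → sumℤ-map _ (t ⊗_) q) p ⟩
    sumℤ (λ t → sumℤ (λ s' → sumℤ (λ s → termCoeff ((t ⊗ s') ⊗ s) m) r) q) p
      ≡⟨ sumℤ-cong (λ t → sumℤ-cong (λ s' → sumℤ-cong (λ s → cong (λ w → termCoeff w m) (⊗-assoc t s' s)) r) q) p ⟩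
    sumℤ (λ t → sumℤ (λ s' → sumℤ (λ s → termCoeff (t ⊗ (s' ⊗ s)) m) r) q) p
      ≡⟨ sumℤ-cong (λ t → sym (trans (sumℤ-concatMap _ _ q) (sumℤ-cong (λ s' → sumℤ-map _ (s' ⊗_) r) q))) p ⟩
    sumℤ (λ t → sumℤ (λ w → termCoeff (t ⊗ w) m) (q *P r)) p
      ≡⟨ coeff-* p (q *P r) m ⟨
    coeff (p *P (q *P r)) m
      ∎
    where
    open ≡-Reasoning
    ⊗-assoc : (t s w : ℤ × Mono N) → (t ⊗ s) ⊗ w ≡ t ⊗ (s ⊗ w)
    ⊗-assoc (c , u) (d , v) (e , x) = cong₂ _,_ (ℤP.*-assoc c d e) (mulMono-assoc u v x)

  *-identityˡ : (p : Poly N) → oneP *P p ≋ p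
  *-identityˡ p = mk≋ λ m → begin
    coeff (oneP *P p) m                                         ≡⟨ coeff-* oneP p m ⟩
    sumℤ (λ s → termCoeff ((+ 1 , unitMono) ⊗ s) m) p ℤ.+ + 0   ≡⟨ ℤP.+-identityʳ _ ⟩
    sumℤ (λ s → termCoeff ((+ 1 , unitMono) ⊗ s) m) p           ≡⟨ sumℤ-cong (λ s → cong (λ w → termCoeff w m) (unit-⊗ s)) p ⟩
    sumℤ (λ s → termCoeff s m) p                                ≡⟨ coeff-sum p m ⟨
    coeff p m                                                   ∎
    where
    open ≡-Reasoning
    unit-⊗ : (s : ℤ × Mono N) → (+ 1 , unitMono) ⊗ s ≡ s
    unit-⊗ (c , u) = cong₂ _,_ (ℤP.*-identityˡ c) (mulMono-identityˡ u)

  *-distribʳ : (r p q : Poly N) → (p +P q) *P r ≋ p *P r +P q *P r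
  *-distribʳ r p q = ≡⇒≋ (ListP.concatMap-++ _ p q)

  -- Multiplication respects equality: by sum-termCoeff-⊗, the coefficients of
  -- p * q depend on q only through the coefficients of q.
  *-congˡ : (p : Poly N) {q q' : Poly N} → q ≋ q' → p *P q ≋ p *P q'
  *-congˡ p {q} {q'} (mk≋ e) = mk≋ λ m →
    trans (coeff-* p q m) (trans (sumℤ-cong (λ t → quotient-sum t m) p) (sym (coeff-* p q' m)))
    where
    quotient-sum : ∀ t m → sumℤ (λ s → termCoeff (t ⊗ s) m) q ≡ sumℤ (λ s → termCoeff (t ⊗ s) m) q'
    quotient-sum (c , u) m =
      trans (sum-termCoeff-⊗ c u q m)
        (trans (cong (λ z → c ℤ.* (if ⌊ mulMono u (m ÷ u) ≟M m ⌋ then z else + 0)) (e (m ÷ u)))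
               (sym (sum-termCoeff-⊗ c u q' m)))

  *-cong : {p p' q q' : Poly N} → p ≋ p' → q ≋ q' → p *P q ≋ p' *P q'
  *-cong {p} {p'} {q} {q'} e f =
    ≋-trans (*-congˡ p f) (≋-trans (*-comm p q') (≋-trans (*-congˡ q' e) (*-comm q' p')))

polySemiring : ℕ → CommutativeSemiring _ _
polySemiring N = record
  { Carrier = Poly N
  ; _≈_ = _≋_
  ; _+_ = _+P_
  ; _*_ = _*P_
  ; 0# = zeroP
  ; 1# = oneP
  ; isCommutativeSemiring = IsCommutativeSemiringˡ.isCommutativeSemiring record
      { +-isCommutativeMonoid = IsCommutativeMonoidˡ.isCommutativeMonoid record
          { isSemigroup = record { isMagma = isMagmaOf _+P_ +-cong ; assoc = +-assoc }
          ; identityˡ = λ p → ≋-refl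
          ; comm = +-comm }
      ; *-isCommutativeMonoid = IsCommutativeMonoidˡ.isCommutativeMonoid record
          { isSemigroup = record { isMagma = isMagmaOf _*P_ *-cong ; assoc = *-assoc }
          ; identityˡ = *-identityˡ
          ; comm = *-comm }
      ; distribʳ = *-distribʳ
      ; zeroˡ = λ p → ≋-refl }
  }
  where
  isMagmaOf : (_∙_ : Poly N → Poly N → Poly N) →
    (∀ {p p' q q'} → p ≋ p' → q ≋ q' → (p ∙ q) ≋ (p' ∙ q')) → IsMagma _≋_ _∙_
  isMagmaOf _∙_ ∙-cong = record
    { isEquivalence = record { refl = ≋-refl ; sym = ≋-sym ; trans = ≋-trans }
    ; ∙-cong = ∙-cong }

module PolyAlgebra (N : ℕ) where
  open CommutativeSemiring (polySemiring N) public
    using (setoid; semiring; +-identityʳ; *-identityʳ; zeroʳ; distribˡ; +-commutativeSemigroup; *-commutativeSemigroup)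
  open SumProps semiring public
    using (sum; sum-syntax; sum-cong-≋; sum-replicate-zero; sum-init-last; sum-remove; ∑-distrib-+; ∑-comm; *-distribˡ-sum)
  open MultProps semiring public
    using (×-homo-+; ×-comm-*) renaming (_×_ to _·_)
  open CommSemigroupProps +-commutativeSemigroup public
    using () renaming (interchange to +-interchange)
  open CommSemigroupProps *-commutativeSemigroup public
    using () renaming (x∙yz≈y∙xz to *-left-comm)

-- The operator ∂ of the
-- theorem is a sum of such maps, and only these properties are used.

record Derivation (N : ℕ) : Set where
  field
    D       : Poly N → Poly N
    D-cong  : ∀ {p q} → p ≋ q → D p ≋ D q
    D-+     : ∀ p q → D (p +P q) ≋ D p +P D q
    D-*     : ∀ p q → D (p *P q) ≋ D p *P q +P p *P D q
    D-zero  : D zeroP ≋ zeroP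
    D-one   : D oneP ≋ zeroP

data Family : Set where
  X Y : Family

module _ {N : ℕ} where

  exponents : Family → Mono N → Vec ℕ N
  exponents X u = proj₁ u
  exponents Y u = proj₂ u

  adjust : Family → (Vec ℕ N → Vec ℕ N) → Mono N → Mono N
  adjust X f u = f (proj₁ u) , proj₂ u
  adjust Y f u = proj₁ u , f (proj₂ u)

  exponents-mul : ∀ F u v → exponents F (mulMono u v) ≡ zipWith ℕ._+_ (exponents F u) (exponents F v)
  exponents-mul X u v = refl
  exponents-mul Y u v = refl

  exponents-unit : ∀ F → exponents F (unitMono {N}) ≡ replicate N 0
  exponents-unit X = refl
  exponents-unit Y = refl

  exponents-adjust : ∀ F f u → exponents F (adjust F f u) ≡ f (exponents F u)
  exponents-adjust X f u = refl
  exponents-adjust Y f u = refl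

  adjust-adjust : ∀ F f g u → adjust F f (adjust F g u) ≡ adjust F (f ∘ g) u
  adjust-adjust X f g u = refl
  adjust-adjust Y f g u = refl

  adjust-id : ∀ F f u → f (exponents F u) ≡ exponents F u → adjust F f u ≡ u
  adjust-id X f u e = cong (_, proj₂ u) e
  adjust-id Y f u e = cong (proj₁ u ,_) e

  adjust-mul : ∀ F {f g} u v →
    zipWith ℕ._+_ (g (exponents F u)) (exponents F v) ≡ f (zipWith ℕ._+_ (exponents F u) (exponents F v)) →
    mulMono (adjust F g u) v ≡ adjust F f (mulMono u v)
  adjust-mul X u v e = cong (_, zipWith ℕ._+_ (proj₂ u) (proj₂ v)) e
  adjust-mul Y u v e = cong (zipWith ℕ._+_ (proj₁ u) (proj₁ v) ,_) e

pred-zipWith : ∀ {n} (i : Fin n) (a b : Vec ℕ n) {r} → lookup a i ≡ suc r →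
  zipWith ℕ._+_ (a [ i ]%= pred) b ≡ zipWith ℕ._+_ a b [ i ]%= pred
pred-zipWith Fin.zero    (suc x ∷ a) (y ∷ b) refl = refl
pred-zipWith (Fin.suc i) (x ∷ a)     (y ∷ b) e    = cong (x ℕ.+ y ∷_) (pred-zipWith i a b e)

module _ {N : ℕ} where

  termCoeff-+ : (a b : ℤ) (u m : Mono N) → termCoeff (a ℤ.+ b , u) m ≡ termCoeff (a , u) m ℤ.+ termCoeff (b , u) m
  termCoeff-+ a b u m with ⌊ u ≟M m ⌋
  ... | true  = refl
  ... | false = refl

  termCoeff-zero : (u m : Mono N) → termCoeff (+ 0 , u) m ≡ + 0
  termCoeff-zero u m with ⌊ u ≟M m ⌋
  ... | true  = refl
  ... | false = refl

  termCoeff-vanish : {a : ℤ} → a ≡ + 0 → (u v m : Mono N) → termCoeff (a , u) m ≡ termCoeff (a , v) m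
  termCoeff-vanish refl u v m = trans (termCoeff-zero u m) (sym (termCoeff-zero v m))

  null-term : {a : ℤ} → a ≡ + 0 → (u : Mono N) → [ (a , u) ] ≋ zeroP
  null-term refl u = mk≋ λ m → trans (ℤP.+-identityʳ _) (termCoeff-zero u m)

  coeff-map : (g : ℤ × Mono N → ℤ × Mono N) (p : Poly N) (m : Mono N) →
    coeff (map g p) m ≡ sumℤ (λ t → termCoeff (g t) m) p
  coeff-map g p m = trans (coeff-sum (map g p) m) (sumℤ-map _ g p)

-- It is a derivation because the exponent of a product is the sum of the
-- exponents (Leibniz rule on single terms, lemma leibniz-term).

module Coordinate {N : ℕ} (F : Family) (i : Fin N) where

  exponent : Mono N → ℕ
  exponent u = lookup (exponents F u) i

  lower raise : Mono N → Mono N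
  lower = adjust F (_[ i ]%= pred)
  raise = adjust F (_[ i ]%= suc)

  ∂term : ℤ × Mono N → ℤ × Mono N
  ∂term t = (proj₁ t ℤ.* + exponent (proj₂ t) , lower (proj₂ t))

  ∂ : Poly N → Poly N
  ∂ = map ∂term

  exponent-mul : ∀ u v → exponent (mulMono u v) ≡ exponent u ℕ.+ exponent v
  exponent-mul u v = trans (cong (λ w → lookup w i) (exponents-mul F u v)) (VecP.lookup-zipWith ℕ._+_ i (exponents F u) (exponents F v))

  exponent-raise : ∀ m → exponent (raise m) ≡ suc (exponent m)
  exponent-raise m = trans (cong (λ w → lookup w i) (exponents-adjust F _ m)) (VecP.lookup∘updateAt i (exponents F m))

  lower-mul : ∀ u v {r} → exponent u ≡ suc r → mulMono (lower u) v ≡ lower (mulMono u v)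
  lower-mul u v e = adjust-mul F u v (pred-zipWith i _ _ e)

  lower-raise : ∀ m → lower (raise m) ≡ m
  lower-raise m = trans (adjust-adjust F _ _ m)
    (adjust-id F _ m (trans (VecP.updateAt-updateAt i (exponents F m)) (VecP.updateAt-id i _)))

  raise-lower : ∀ u {r} → exponent u ≡ suc r → raise (lower u) ≡ u
  raise-lower u e = trans (adjust-adjust F _ _ u)
    (adjust-id F _ u (trans (VecP.updateAt-updateAt-local i {h = id} _ (trans (cong (suc ∘ pred) e) (sym e)))
                            (VecP.updateAt-id i _)))

  exponent-unit : exponent unitMono ≡ 0
  exponent-unit = trans (cong (λ w → lookup w i) (exponents-unit F)) (VecP.lookup-replicate i 0)

  termCoeff-∂ : (t : ℤ × Mono N) (m : Mono N) →
    termCoeff (∂term t) m ≡ termCoeff t (raise m) ℤ.* + suc (exponent m)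
  termCoeff-∂ (c , u) m with u ≟M raise m
  ... | yes refl =
    trans (cong (λ b → if b then c ℤ.* + exponent (raise m) else + 0) (isYes-true (lower (raise m) ≟M m) (lower-raise m)))
          (cong (λ e → c ℤ.* + e) (exponent-raise m))
  ... | no u≢raise-m with lower u ≟M m | exponent u in eu
  ...   | no _     | _     = refl
  ...   | yes refl | zero  = ℤP.*-zeroʳ c
  ...   | yes refl | suc r = ⊥-elim (u≢raise-m (sym (raise-lower u eu)))

  coeff-∂ : (p : Poly N) (m : Mono N) → coeff (∂ p) m ≡ coeff p (raise m) ℤ.* + suc (exponent m)
  coeff-∂ p m = begin
    coeff (∂ p) m                                                ≡⟨ coeff-map ∂term p m ⟩
    sumℤ (λ t → termCoeff (∂term t) m) p                          ≡⟨ sumℤ-cong (λ t → trans (termCoeff-∂ t m) (ℤP.*-comm _ k)) p ⟩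
    sumℤ (λ t → k ℤ.* termCoeff t (raise m)) p                    ≡⟨ sumℤ-*ˡ k _ p ⟩
    k ℤ.* sumℤ (λ t → termCoeff t (raise m)) p                    ≡⟨ cong (k ℤ.*_) (coeff-sum p (raise m)) ⟨
    k ℤ.* coeff p (raise m)                                      ≡⟨ ℤP.*-comm k _ ⟩
    coeff p (raise m) ℤ.* k                                      ∎
    where
    open ≡-Reasoning
    k = + suc (exponent m)

  -- Leibniz rule for a product of two terms: the exponent of u·v is the sum
  -- of the exponents; a term with exponent 0 is killed whatever its monomial.
  leibniz-term : (t s : ℤ × Mono N) (m : Mono N) →
    termCoeff (∂term (t ⊗ s)) m ≡ termCoeff (∂term t ⊗ s) m ℤ.+ termCoeff (t ⊗ ∂term s) m
  leibniz-term (c , u) (d , v) m = begin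
    termCoeff (c ℤ.* d ℤ.* + exponent (mulMono u v) , w) m
      ≡⟨ cong (λ a → termCoeff (a , w) m) (split (exponent-mul u v)) ⟩
    termCoeff (c ℤ.* + exponent u ℤ.* d ℤ.+ c ℤ.* (d ℤ.* + exponent v) , w) m
      ≡⟨ termCoeff-+ _ _ w m ⟩
    termCoeff (c ℤ.* + exponent u ℤ.* d , w) m ℤ.+ termCoeff (c ℤ.* (d ℤ.* + exponent v) , w) m
      ≡⟨ cong₂ ℤ._+_ left right ⟩
    termCoeff (c ℤ.* + exponent u ℤ.* d , mulMono (lower u) v) m ℤ.+ termCoeff (c ℤ.* (d ℤ.* + exponent v) , mulMono u (lower v)) m
      ∎
    where
    open ≡-Reasoning
    w = lower (mulMono u v)
    split : ∀ {e} → e ≡ exponent u ℕ.+ exponent v →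
      c ℤ.* d ℤ.* + e ≡ c ℤ.* + exponent u ℤ.* d ℤ.+ c ℤ.* (d ℤ.* + exponent v)
    split refl = trans (cong (c ℤ.* d ℤ.*_) (ℤP.pos-+ (exponent u) (exponent v)))
      (solve 4 (λ c d x y → c :* d :* (x :+ y) := c :* x :* d :+ c :* (d :* y)) refl c d (+ exponent u) (+ exponent v))
      where open +-*-Solver
    left : termCoeff (c ℤ.* + exponent u ℤ.* d , w) m ≡ termCoeff (c ℤ.* + exponent u ℤ.* d , mulMono (lower u) v) m
    left with exponent u in eu
    ... | zero  = termCoeff-vanish (trans (cong (ℤ._* d) (ℤP.*-zeroʳ c)) (ℤP.*-zeroˡ d)) w _ m
    ... | suc r = cong (λ x → termCoeff (c ℤ.* + suc r ℤ.* d , x) m) (sym (lower-mul u v eu))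
    right : termCoeff (c ℤ.* (d ℤ.* + exponent v) , w) m ≡ termCoeff (c ℤ.* (d ℤ.* + exponent v) , mulMono u (lower v)) m
    right with exponent v in ev
    ... | zero  = termCoeff-vanish (trans (cong (c ℤ.*_) (ℤP.*-zeroʳ d)) (ℤP.*-zeroʳ c)) w _ m
    ... | suc r = cong (λ x → termCoeff (c ℤ.* (d ℤ.* + suc r) , x) m)
                       (sym (trans (mulMono-comm u (lower v)) (trans (lower-mul v u ev) (cong lower (mulMono-comm v u)))))

  ∂-* : (p q : Poly N) → ∂ (p *P q) ≋ ∂ p *P q +P p *P ∂ q
  ∂-* p q = mk≋ λ m → begin
    coeff (∂ (p *P q)) m
      ≡⟨ coeff-map ∂term (p *P q) m ⟩
    sumℤ (λ w → termCoeff (∂term w) m) (p *P q)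
      ≡⟨ sumℤ-concatMap _ _ p ⟩
    sumℤ (λ t → sumℤ (λ w → termCoeff (∂term w) m) (map (t ⊗_) q)) p
      ≡⟨ sumℤ-cong (λ t → sumℤ-map _ (t ⊗_) q) p ⟩
    sumℤ (λ t → sumℤ (λ s → termCoeff (∂term (t ⊗ s)) m) q) p
      ≡⟨ sumℤ-cong (λ t → trans (sumℤ-cong (λ s → leibniz-term t s m) q) (sumℤ-+ _ _ q)) p ⟩
    sumℤ (λ t → sumℤ (λ s → termCoeff (∂term t ⊗ s) m) q ℤ.+ sumℤ (λ s → termCoeff (t ⊗ ∂term s) m) q) p
      ≡⟨ sumℤ-+ _ _ p ⟩
    sumℤ (λ t → sumℤ (λ s → termCoeff (∂term t ⊗ s) m) q) p ℤ.+ sumℤ (λ t → sumℤ (λ s → termCoeff (t ⊗ ∂term s) m) q) p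
      ≡⟨ cong₂ ℤ._+_ (trans (coeff-* (∂ p) q m) (sumℤ-map _ ∂term p))
                     (trans (coeff-* p (∂ q) m) (sumℤ-cong (λ t → sumℤ-map _ ∂term q) p)) ⟨
    coeff (∂ p *P q) m ℤ.+ coeff (p *P ∂ q) m
      ≡⟨ coeff-++ (∂ p *P q) (p *P ∂ q) m ⟨
    coeff (∂ p *P q +P p *P ∂ q) m
      ∎
    where open ≡-Reasoning

  ∂-constant : (c : ℤ) (u : Mono N) → exponent u ≡ 0 → ∂ [ (c , u) ] ≋ zeroP
  ∂-constant c u e = null-term (trans (cong (λ x → c ℤ.* + x) e) (ℤP.*-zeroʳ c)) (lower u)

  ∂-variable : (u : Mono N) → exponent u ≡ 1 → lower u ≡ unitMono → ∂ [ (+ 1 , u) ] ≋ oneP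
  ∂-variable u e l = ≡⇒≋ (cong₂ (λ x w → [ (+ 1 ℤ.* + x , w) ]) e l)

  derivation : Derivation N
  derivation = record
    { D      = ∂
    ; D-cong = λ {p} {q} (mk≋ e) → mk≋ λ m →
        trans (coeff-∂ p m) (trans (cong (ℤ._* + suc (exponent m)) (e (raise m))) (sym (coeff-∂ q m)))
    ; D-+    = λ p q → ≡⇒≋ (ListP.map-++ ∂term p q)
    ; D-*    = ∂-*
    ; D-zero = ≋-refl
    ; D-one  = ∂-constant (+ 1) unitMono exponent-unit
    }

module _ {N : ℕ} where
  open PolyAlgebra N

  when : Bool → Poly N → Poly N
  when b p = if b then p else zeroP

  when-cong : (b : Bool) {p q : Poly N} → p ≋ q → when b p ≋ when b q
  when-cong true  e = e
  when-cong false e = ≋-refl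

  when-zero : (b : Bool) → when b zeroP ≋ zeroP
  when-zero true  = ≋-refl
  when-zero false = ≋-refl

  when-* : (b : Bool) (p q : Poly N) → when b (p *P q) ≋ p *P when b q
  when-* true  p q = ≋-refl
  when-* false p q = ≋-sym (zeroʳ p)

  when-+ : (b : Bool) (p q : Poly N) → when b (p +P q) ≋ when b p +P when b q
  when-+ true  p q = ≋-refl
  when-+ false p q = ≋-refl

  when-∑ : ∀ {M} (b : Bool) (f : Fin M → Poly N) → when b (∑[ j < M ] f j) ≋ ∑[ j < M ] when b (f j)
  when-∑ {M} true  f = ≋-refl
  when-∑ {M} false f = ≋-sym (sum-replicate-zero M)

  ∑-zero : ∀ {M} (f : Fin M → Poly N) → (∀ j → f j ≋ zeroP) → ∑[ j < M ] f j ≋ zeroP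
  ∑-zero {M} f e = ≋-trans (sum-cong-≋ e) (sum-replicate-zero M)

  sumP-filter : {A : Set} {P : A → Set} (P? : ∀ a → Dec (P a)) (f : A → Poly N) (xs : List A) →
    sumP (map f (filter P? xs)) ≋ sumP (map (λ a → when (does (P? a)) (f a)) xs)
  sumP-filter P? f []       = ≋-refl
  sumP-filter P? f (x ∷ xs) with does (P? x)
  ... | true  = +-cong (≋-refl {p = f x}) (sumP-filter P? f xs)
  ... | false = sumP-filter P? f xs

  sumP-allFin : ∀ {M} (h : Fin M → Poly N) → sumP (map h (allFin M)) ≡ ∑[ i < M ] h i
  sumP-allFin h = trans (cong sumP (ListP.map-tabulate id h)) (tabulated h)
    where
    tabulated : ∀ {M} (h : Fin M → Poly N) → sumP (List.tabulate h) ≡ ∑[ i < M ] h i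
    tabulated {zero}  h = refl
    tabulated {suc M} h = cong (h Fin.zero +P_) (tabulated (h ∘ Fin.suc))

  sumP-++ : (xs ys : List (Poly N)) → sumP (xs ++ ys) ≋ sumP xs +P sumP ys
  sumP-++ []       ys = ≋-refl
  sumP-++ (x ∷ xs) ys = ≋-trans (+-cong (≋-refl {p = x}) (sumP-++ xs ys)) (≋-sym (+-assoc x (sumP xs) (sumP ys)))

  sumP-concatMap : {A B : Set} (h : B → Poly N) (F : A → List B) (L : List A) →
    sumP (map h (concatMap F L)) ≋ sumP (map (λ a → sumP (map h (F a))) L)
  sumP-concatMap h F []      = ≋-refl
  sumP-concatMap h F (a ∷ L) = ≋-trans (≡⇒≋ (cong sumP (ListP.map-++ h (F a) (concatMap F L))))
    (≋-trans (sumP-++ (map h (F a)) _) (+-cong (≋-refl {p = sumP (map h (F a))}) (sumP-concatMap h F L)))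

  sumP-cong : {A : Set} {g h : A → Poly N} → (∀ a → g a ≋ h a) → (L : List A) → sumP (map g L) ≋ sumP (map h L)
  sumP-cong e []      = ≋-refl
  sumP-cong e (a ∷ L) = +-cong (e a) (sumP-cong e L)

  sumP-* : {A : Set} (p : Poly N) (g : A → Poly N) (L : List A) → sumP (map (λ a → p *P g a) L) ≋ p *P sumP (map g L)
  sumP-* p g []      = ≋-sym (zeroʳ p)
  sumP-* p g (a ∷ L) = ≋-trans (+-cong (≋-refl {p = p *P g a}) (sumP-* p g L)) (≋-sym (distribˡ p (g a) _))

  sumP-when : {A : Set} (b : Bool) (g : A → Poly N) (L : List A) → sumP (map (λ a → when b (g a)) L) ≋ when b (sumP (map g L))
  sumP-when true  g L = ≋-refl
  sumP-when false g []      = ≋-refl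
  sumP-when false g (a ∷ L) = sumP-when false g L

  ∑-delta : ∀ {n} (g : Fin n → Poly N) (v : Fin n) → ∑[ i < n ] when ⌊ i Fin.≟ v ⌋ (g i) ≋ g v
  ∑-delta {suc n} g v = begin
    ∑[ i < suc n ] when ⌊ i Fin.≟ v ⌋ (g i)
      ≈⟨ sum-remove {i = v} (λ i → when ⌊ i Fin.≟ v ⌋ (g i)) ⟩
    when ⌊ v Fin.≟ v ⌋ (g v) +P ∑[ j < n ] when ⌊ punchIn v j Fin.≟ v ⌋ (g (punchIn v j))
      ≈⟨ +-cong (≡⇒≋ (cong (λ b → when b (g v)) (isYes-true (v Fin.≟ v) refl))) others-vanish ⟩
    g v +P zeroP
      ≈⟨ +-identityʳ (g v) ⟩
    g v ∎
    where
    open SetoidReasoning setoid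
    others-vanish : ∑[ j < n ] when ⌊ punchIn v j Fin.≟ v ⌋ (g (punchIn v j)) ≋ zeroP
    others-vanish = ∑-zero _ λ j →
      ≡⇒≋ (cong (λ b → when b (g (punchIn v j))) (isYes-false (punchIn v j Fin.≟ v) (FinP.punchInᵢ≢i v j)))

module _ {N : ℕ} where
  open PolyAlgebra N
  open Derivation

  leibniz-+ : (D₁ D₂ : Poly N → Poly N) (p q : Poly N) →
    D₁ (p *P q) ≋ D₁ p *P q +P p *P D₁ q → D₂ (p *P q) ≋ D₂ p *P q +P p *P D₂ q →
    D₁ (p *P q) +P D₂ (p *P q) ≋ (D₁ p +P D₂ p) *P q +P p *P (D₁ q +P D₂ q)
  leibniz-+ D₁ D₂ p q e₁ e₂ = begin
    D₁ (p *P q) +P D₂ (p *P q)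
      ≈⟨ +-cong e₁ e₂ ⟩
    (D₁ p *P q +P p *P D₁ q) +P (D₂ p *P q +P p *P D₂ q)
      ≈⟨ +-interchange (D₁ p *P q) (p *P D₁ q) (D₂ p *P q) (p *P D₂ q) ⟩
    (D₁ p *P q +P D₂ p *P q) +P (p *P D₁ q +P p *P D₂ q)
      ≈⟨ +-cong (≋-sym (*-distribʳ q (D₁ p) (D₂ p))) (≋-sym (distribˡ p (D₁ q) (D₂ q))) ⟩
    (D₁ p +P D₂ p) *P q +P p *P (D₁ q +P D₂ q)
      ∎
    where open SetoidReasoning setoid

  zeroDerivation : Derivation N
  zeroDerivation = record
    { D = λ _ → zeroP ; D-cong = λ _ → ≋-refl ; D-+ = λ _ _ → ≋-refl
    ; D-* = λ p q → ≋-sym (zeroʳ p) ; D-zero = ≋-refl ; D-one = ≋-refl }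

  infixl 6 _⊕_
  _⊕_ : Derivation N → Derivation N → Derivation N
  d₁ ⊕ d₂ = record
    { D      = λ p → D d₁ p +P D d₂ p
    ; D-cong = λ e → +-cong (D-cong d₁ e) (D-cong d₂ e)
    ; D-+    = λ p q → ≋-trans (+-cong (D-+ d₁ p q) (D-+ d₂ p q)) (+-interchange (D d₁ p) (D d₁ q) (D d₂ p) (D d₂ q))
    ; D-*    = λ p q → leibniz-+ (D d₁) (D d₂) p q (D-* d₁ p q) (D-* d₂ p q)
    ; D-zero = +-cong (D-zero d₁) (D-zero d₂)
    ; D-one  = +-cong (D-one d₁) (D-one d₂) }

  ∑ᴰ : {A : Set} → (A → Derivation N) → List A → Derivation N
  ∑ᴰ f []      = zeroDerivation
  ∑ᴰ f (a ∷ L) = f a ⊕ ∑ᴰ f L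

  ∑ᴰ-apply : {A : Set} (f : A → Derivation N) (L : List A) (p : Poly N) →
    D (∑ᴰ f L) p ≡ sumP (map (λ a → D (f a) p) L)
  ∑ᴰ-apply f []      p = refl
  ∑ᴰ-apply f (a ∷ L) p = cong (D (f a) p +P_) (∑ᴰ-apply f L p)

∂-derivation : (n k : ℕ) → Derivation n
∂-derivation n k =
  ∑ᴰ (Coordinate.derivation X) (filter (λ i → toℕ i ℕ.<? (n ℕ.∸ k)) (allFin n))
  ⊕ ∑ᴰ (Coordinate.derivation Y) (filter (λ j → toℕ j ℕ.<? (n ℕ.∸ 1)) (allFin n))

∂-derivation-apply : (n k : ℕ) (p : Poly n) → Derivation.D (∂-derivation n k) p ≡ ∂op n k p
∂-derivation-apply n k p =
  cong₂ _+P_ (∑ᴰ-apply (Coordinate.derivation X) (filter (λ i → toℕ i ℕ.<? (n ℕ.∸ k)) (allFin n)) p)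
             (∑ᴰ-apply (Coordinate.derivation Y) (filter (λ j → toℕ j ℕ.<? (n ℕ.∸ 1)) (allFin n)) p)

var : ∀ {N} → Family → Fin N → Poly N
var F v = [ (+ 1 , adjust F (λ _ → δ v) unitMono) ]

vec-ext : ∀ {n} {a b : Vec ℕ n} → (∀ i → lookup a i ≡ lookup b i) → a ≡ b
vec-ext {a = a} {b} e = trans (sym (VecP.tabulate∘lookup a)) (trans (VecP.tabulate-cong e) (VecP.tabulate∘lookup b))

module _ {N : ℕ} where

  lookup-δ : (v i : Fin N) → lookup (δ v) i ≡ (if ⌊ i Fin.≟ v ⌋ then 1 else 0)
  lookup-δ v i = VecP.lookup∘tabulate _ i

  δ-lower : (v : Fin N) → δ v [ v ]%= pred ≡ replicate N 0
  δ-lower v = vec-ext entry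
    where
    entry : ∀ j → lookup (δ v [ v ]%= pred) j ≡ lookup (replicate N 0) j
    entry j with j Fin.≟ v
    ... | yes refl = trans (VecP.lookup∘updateAt j (δ j)) (trans (cong pred (lookup-δ j j))
                       (trans (cong (λ b → pred (if b then 1 else 0)) (isYes-true (j Fin.≟ j) refl))
                              (sym (VecP.lookup-replicate j 0))))
    ... | no j≢v   = trans (VecP.lookup∘updateAt′ j v (j≢v) (δ v))
                       (trans (lookup-δ v j) (trans (cong (λ b → if b then 1 else 0) (isYes-false (j Fin.≟ v) j≢v))
                              (sym (VecP.lookup-replicate j 0))))

  ∂-own-variable : (F : Family) (i v : Fin N) → Coordinate.∂ F i (var F v) ≋ when ⌊ i Fin.≟ v ⌋ oneP
  ∂-own-variable F i v with i Fin.≟ v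
  ... | yes refl = Coordinate.∂-variable F i _
        (trans (cong (λ w → lookup w i) (exponents-adjust F _ unitMono))
               (trans (lookup-δ i i) (cong (λ b → if b then 1 else 0) (isYes-true (i Fin.≟ i) refl))))
        (trans (adjust-adjust F _ _ unitMono) (adjust-id F _ unitMono (trans (δ-lower i) (sym (exponents-unit F)))))
  ... | no i≢v   = Coordinate.∂-constant F i (+ 1) _
        (trans (cong (λ w → lookup w i) (exponents-adjust F _ unitMono))
               (trans (lookup-δ v i) (cong (λ b → if b then 1 else 0) (isYes-false (i Fin.≟ v) i≢v))))

  ∂x-yv : (i v : Fin N) → ∂x i (yv v) ≋ zeroP
  ∂x-yv i v = Coordinate.∂-constant X i (+ 1) _ (VecP.lookup-replicate i 0)

  ∂y-xv : (i v : Fin N) → ∂y i (xv v) ≋ zeroP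
  ∂y-xv i v = Coordinate.∂-constant Y i (+ 1) _ (VecP.lookup-replicate i 0)

module _ (n k : ℕ) where
  open PolyAlgebra n
  open SetoidReasoning setoid

  private
    filtered-sum : {P : Fin n → Set} (P? : ∀ i → Dec (P i)) (f : Fin n → Poly n) →
      sumP (map f (filter P? (allFin n))) ≋ ∑[ i < n ] when (does (P? i)) (f i)
    filtered-sum P? f = ≋-trans (sumP-filter P? f (allFin n)) (≡⇒≋ (sumP-allFin λ i → when (does (P? i)) (f i)))

    guarded-delta : (P : Fin n → Bool) (v : Fin n) → ∑[ i < n ] when (P i) (when ⌊ i Fin.≟ v ⌋ oneP) ≋ when (P v) oneP
    guarded-delta P v = ≋-trans (sum-cong-≋ λ i → ≡⇒≋ (swap (P i) ⌊ i Fin.≟ v ⌋)) (∑-delta (λ i → when (P i) oneP) v)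
      where
      swap : ∀ a b → when a (when b oneP) ≡ when b (when a (oneP {n}))
      swap true  b     = refl
      swap false true  = refl
      swap false false = refl

    vanishing : (P : Fin n → Bool) (f : Fin n → Poly n) → (∀ i → f i ≋ zeroP) → ∑[ i < n ] when (P i) (f i) ≋ zeroP
    vanishing P f e = ∑-zero _ λ i → ≋-trans (when-cong (P i) (e i)) (when-zero (P i))

  ∂op-xv : (v : Fin n) → ∂op n k (xv v) ≋ when (toℕ v ℕ.<ᵇ n ℕ.∸ k) oneP
  ∂op-xv v = begin
    ∂op n k (xv v)
      ≈⟨ +-cong (filtered-sum (λ i → toℕ i ℕ.<? (n ℕ.∸ k)) (λ i → ∂x i (xv v)))
                (filtered-sum (λ j → toℕ j ℕ.<? (n ℕ.∸ 1)) (λ j → ∂y j (xv v))) ⟩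
    ∑[ i < n ] when (toℕ i ℕ.<ᵇ n ℕ.∸ k) (∂x i (xv v)) +P ∑[ j < n ] when (toℕ j ℕ.<ᵇ n ℕ.∸ 1) (∂y j (xv v))
      ≈⟨ +-cong (≋-trans (sum-cong-≋ λ i → when-cong _ (∂-own-variable X i v)) (guarded-delta (λ i → toℕ i ℕ.<ᵇ n ℕ.∸ k) v))
                (vanishing _ _ λ j → ∂y-xv j v) ⟩
    when (toℕ v ℕ.<ᵇ n ℕ.∸ k) oneP +P zeroP
      ≈⟨ +-identityʳ _ ⟩
    when (toℕ v ℕ.<ᵇ n ℕ.∸ k) oneP ∎

  ∂op-yv : (v : Fin n) → ∂op n k (yv v) ≋ when (toℕ v ℕ.<ᵇ n ℕ.∸ 1) oneP
  ∂op-yv v = begin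
    ∂op n k (yv v)
      ≈⟨ +-cong (filtered-sum (λ i → toℕ i ℕ.<? (n ℕ.∸ k)) (λ i → ∂x i (yv v)))
                (filtered-sum (λ j → toℕ j ℕ.<? (n ℕ.∸ 1)) (λ j → ∂y j (yv v))) ⟩
    ∑[ i < n ] when (toℕ i ℕ.<ᵇ n ℕ.∸ k) (∂x i (yv v)) +P ∑[ j < n ] when (toℕ j ℕ.<ᵇ n ℕ.∸ 1) (∂y j (yv v))
      ≈⟨ +-cong (vanishing _ _ λ i → ∂x-yv i v)
                (≋-trans (sum-cong-≋ λ j → when-cong _ (∂-own-variable Y j v)) (guarded-delta (λ j → toℕ j ℕ.<ᵇ n ℕ.∸ 1) v)) ⟩
    zeroP +P when (toℕ v ℕ.<ᵇ n ℕ.∸ 1) oneP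
      ≡⟨⟩
    when (toℕ v ℕ.<ᵇ n ℕ.∸ 1) oneP ∎

-- Sets of columns are boolean predicates (true = the column is available).
-- remove A j takes column j away; count A is the number of available columns.

remove : ∀ {M} → (Fin M → Bool) → Fin M → Fin M → Bool
remove A j j' = A j' ∧ not ⌊ j' Fin.≟ j ⌋

count : ∀ {M} → (Fin M → Bool) → ℕ
count {zero}  A = 0
count {suc M} A = (if A Fin.zero then 1 else 0) ℕ.+ count (A ∘ Fin.suc)

everything : ∀ {M} → Fin M → Bool
everything _ = true

count-all : ∀ M → count {M} everything ≡ M
count-all zero    = refl
count-all (suc M) = cong suc (count-all M)

count-cong : ∀ {M} {A A' : Fin M → Bool} → (∀ j → A j ≡ A' j) → count A ≡ count A'
count-cong {zero}  e = refl
count-cong {suc M} e = cong₂ ℕ._+_ (cong (λ b → if b then 1 else 0) (e Fin.zero)) (count-cong (e ∘ Fin.suc))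

≟-sym : ∀ {M} (a b : Fin M) → ⌊ a Fin.≟ b ⌋ ≡ ⌊ b Fin.≟ a ⌋
≟-sym a b with a Fin.≟ b
... | yes refl = sym (isYes-true (a Fin.≟ a) refl)
... | no a≢b   = sym (isYes-false (b Fin.≟ a) (λ e → a≢b (sym e)))

≟-suc : ∀ {M} (a b : Fin M) → ⌊ Fin.suc a Fin.≟ Fin.suc b ⌋ ≡ ⌊ a Fin.≟ b ⌋
≟-suc a b with a Fin.≟ b
... | yes refl = refl
... | no _     = refl

count-remove : ∀ {M} (A : Fin M → Bool) (j : Fin M) → A j ≡ true → count A ≡ suc (count (remove A j))
count-remove {suc M} A Fin.zero e rewrite e =
  cong suc (count-cong λ j → sym (BoolP.∧-identityʳ (A (Fin.suc j))))
count-remove {suc M} A (Fin.suc j) e =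
  trans (cong (c ℕ.+_) (count-remove (A ∘ Fin.suc) j e))
  (trans (ℕP.+-suc c _)
    (cong suc (cong₂ ℕ._+_ (cong (λ b → if b then 1 else 0) (sym (BoolP.∧-identityʳ (A Fin.zero))))
                           (count-cong λ x → cong (λ b → A (Fin.suc x) ∧ not b) (sym (≟-suc x j))))))
  where c = if A Fin.zero then 1 else 0

count-remove-+ : ∀ {M} (A : Fin M → Bool) (j : Fin M) → A j ≡ true →
  ∀ r {K} → count A ≡ r ℕ.+ suc K → count (remove A j) ≡ r ℕ.+ K
count-remove-+ A j avail r {K} e = ℕP.suc-injective (trans (sym (count-remove A j avail)) (trans e (ℕP.+-suc r K)))

remove-comm : ∀ {M} (A : Fin M → Bool) (j j' x : Fin M) → remove (remove A j) j' x ≡ remove (remove A j') j x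
remove-comm A j j' x = trans (BoolP.∧-assoc (A x) _ _)
  (trans (cong (A x ∧_) (BoolP.∧-comm (not ⌊ x Fin.≟ j ⌋) _)) (sym (BoolP.∧-assoc (A x) _ _)))

-- Partial permanents: perm K H A is the sum, over injective placements of the
-- K rows of H into available columns, of the products of the chosen entries.

module _ {N : ℕ} where
  open PolyAlgebra N

  perm : (K : ℕ) {M : ℕ} → (Fin K → Fin M → Poly N) → (Fin M → Bool) → Poly N
  perm zero    H A = oneP
  perm (suc K) H A = ∑[ j < _ ] when (A j) (H Fin.zero j *P perm K (H ∘ Fin.suc) (remove A j))

  perm-cong : ∀ K {M} {H H' : Fin K → Fin M → Poly N} {A A' : Fin M → Bool} →
    (∀ r j → H r j ≋ H' r j) → (∀ j → A j ≡ A' j) → perm K H A ≋ perm K H' A'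
  perm-cong zero    eH eA = ≋-refl
  perm-cong (suc K) {H = H} {H'} {A} {A'} eH eA = sum-cong-≋ λ j → ≡-when (eA j)
    (*-cong (eH Fin.zero j) (perm-cong K (eH ∘ Fin.suc) λ x → cong (_∧ not ⌊ x Fin.≟ j ⌋) (eA x)))
    where
    ≡-when : ∀ {a b} {p q : Poly N} → a ≡ b → p ≋ q → when a p ≋ when b q
    ≡-when {a} refl e = when-cong a e

  ∑-when-constant : ∀ {M} (A : Fin M → Bool) (p : Poly N) → ∑[ j < M ] when (A j) p ≋ count A · p
  ∑-when-constant {zero}  A p = ≋-refl
  ∑-when-constant {suc M} A p = begin
    when (A Fin.zero) p +P ∑[ j < M ] when (A (Fin.suc j)) p    ≈⟨ +-cong (head (A Fin.zero)) (∑-when-constant (A ∘ Fin.suc) p) ⟩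
    (if A Fin.zero then 1 else 0) · p +P count (A ∘ Fin.suc) · p ≈⟨ ≋-sym (×-homo-+ p (if A Fin.zero then 1 else 0) _) ⟩
    count A · p                                                ∎
    where
    open SetoidReasoning setoid
    head : ∀ b → when b p ≋ (if b then 1 else 0) · p
    head true  = ≋-sym (+-identityʳ p)
    head false = ≋-refl

  when-∧ : (a b : Bool) (p : Poly N) → when a (when b p) ≡ when (a ∧ b) p
  when-∧ true  b p = refl
  when-∧ false b p = refl

  perm-ones-row : ∀ K {M} (G : Fin K → Fin M → Poly N) (A : Fin M → Bool) (r : ℕ) → count A ≡ r ℕ.+ K →
    ∑[ j < M ] when (A j) (perm K G (remove A j)) ≋ (r · oneP) *P perm K G A
  perm-ones-row zero G A r e = begin
    ∑[ j < _ ] when (A j) oneP ≈⟨ ∑-when-constant A oneP ⟩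
    count A · oneP             ≡⟨ cong (_· oneP) (trans e (ℕP.+-identityʳ r)) ⟩
    r · oneP                   ≈⟨ *-identityʳ (r · oneP) ⟨
    (r · oneP) *P oneP         ∎
    where open SetoidReasoning setoid
  perm-ones-row (suc K) {M} G A r e = begin
    ∑[ j < M ] when (A j) (∑[ j' < M ] when (remove A j j') (term j j'))
      ≈⟨ sum-cong-≋ (λ j → when-∑ (A j) λ j' → when (remove A j j') (term j j')) ⟩
    ∑[ j < M ] ∑[ j' < M ] when (A j) (when (remove A j j') (term j j'))
      ≈⟨ ∑-comm (λ j j' → when (A j) (when (remove A j j') (term j j'))) ⟩
    ∑[ j' < M ] ∑[ j < M ] when (A j) (when (remove A j j') (term j j'))
      ≈⟨ sum-cong-≋ column ⟩
    ∑[ j' < M ] when (A j') (G Fin.zero j' *P ((r · oneP) *P perm K G' (remove A j')))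
      ≈⟨ sum-cong-≋ (λ j' → ≋-trans (when-cong (A j') (*-left-comm (G Fin.zero j') (r · oneP) (perm K G' (remove A j'))))
                                    (when-* (A j') (r · oneP) (G Fin.zero j' *P perm K G' (remove A j')))) ⟩
    ∑[ j' < M ] ((r · oneP) *P when (A j') (G Fin.zero j' *P perm K G' (remove A j')))
      ≈⟨ *-distribˡ-sum (r · oneP) (λ j' → when (A j') (G Fin.zero j' *P perm K G' (remove A j'))) ⟨
    (r · oneP) *P perm (suc K) G A ∎
    where
    open SetoidReasoning setoid
    G' = G ∘ Fin.suc
    term : Fin M → Fin M → Poly N
    term j j' = G Fin.zero j' *P perm K G' (remove (remove A j) j')
    column : ∀ j' → ∑[ j < M ] when (A j) (when (remove A j j') (term j j'))
                    ≋ when (A j') (G Fin.zero j' *P ((r · oneP) *P perm K G' (remove A j')))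
    column j' with A j' in avail
    ... | false = ∑-zero _ λ j → when-zero (A j)
    ... | true  = begin
      ∑[ j < M ] when (A j) (when (not ⌊ j' Fin.≟ j ⌋) (term j j'))
        ≈⟨ sum-cong-≋ reindex ⟩
      ∑[ j < M ] (G Fin.zero j' *P when (remove A j' j) (perm K G' (remove (remove A j') j)))
        ≈⟨ *-distribˡ-sum (G Fin.zero j') (λ j → when (remove A j' j) (perm K G' (remove (remove A j') j))) ⟨
      G Fin.zero j' *P ∑[ j < M ] when (remove A j' j) (perm K G' (remove (remove A j') j))
        ≈⟨ *-congˡ (G Fin.zero j') (perm-ones-row K G' (remove A j') r count-rest) ⟩
      G Fin.zero j' *P ((r · oneP) *P perm K G' (remove A j')) ∎
      where
      count-rest : count (remove A j') ≡ r ℕ.+ K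
      count-rest = count-remove-+ A j' avail r e
      -- Column j' is still free after taking j exactly when j ≠ j'.
      reindex : ∀ j → when (A j) (when (not ⌊ j' Fin.≟ j ⌋) (term j j'))
                      ≋ G Fin.zero j' *P when (remove A j' j) (perm K G' (remove (remove A j') j))
      reindex j =
        ≋-trans (≡⇒≋ (trans (when-∧ (A j) _ _) (cong (λ b → when (A j ∧ not b) (term j j')) (≟-sym j' j))))
          (≋-trans (when-cong (remove A j' j) (*-congˡ (G Fin.zero j') (perm-cong K (λ _ _ → ≋-refl) (remove-comm A j j'))))
                   (when-* (remove A j' j) (G Fin.zero j') _))

  perm-constant-row : ∀ K {M} (H : Fin (suc K) → Fin M → Poly N) (A : Fin M → Bool) (i : Fin (suc K)) (c : Poly N) (r : ℕ) →
    (∀ j → H i j ≋ c) → count A ≡ r ℕ.+ K → perm (suc K) H A ≋ (r · oneP) *P (c *P perm K (VecF.removeAt H i) A)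
  perm-constant-row K {M} H A Fin.zero c r row e = begin
    ∑[ j < M ] when (A j) (H Fin.zero j *P perm K H' (remove A j))
      ≈⟨ sum-cong-≋ (λ j → ≋-trans (when-cong (A j) (*-cong (row j) ≋-refl)) (when-* (A j) c _)) ⟩
    ∑[ j < M ] (c *P when (A j) (perm K H' (remove A j)))
      ≈⟨ *-distribˡ-sum c (λ j → when (A j) (perm K H' (remove A j))) ⟨
    c *P ∑[ j < M ] when (A j) (perm K H' (remove A j))
      ≈⟨ *-congˡ c (perm-ones-row K H' A r e) ⟩
    c *P ((r · oneP) *P perm K H' A)
      ≈⟨ *-left-comm c (r · oneP) _ ⟩
    (r · oneP) *P (c *P perm K H' A) ∎
    where
    open SetoidReasoning setoid
    H' = H ∘ Fin.suc
  perm-constant-row (suc K) {M} H A (Fin.suc i) c r row e = begin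
    ∑[ j < M ] when (A j) (H Fin.zero j *P perm (suc K) H' (remove A j))
      ≈⟨ sum-cong-≋ step ⟩
    ∑[ j < M ] ((r · oneP) *P (c *P when (A j) (H Fin.zero j *P perm K (VecF.removeAt H' i) (remove A j))))
      ≈⟨ *-distribˡ-sum (r · oneP) (λ j → c *P row-term j) ⟨
    (r · oneP) *P ∑[ j < M ] (c *P row-term j)
      ≈⟨ *-congˡ (r · oneP) (*-distribˡ-sum c row-term) ⟨
    (r · oneP) *P (c *P perm (suc K) (VecF.removeAt H (Fin.suc i)) A) ∎
    where
    open SetoidReasoning setoid
    H' = H ∘ Fin.suc
    row-term : Fin M → Poly N
    row-term j = when (A j) (H Fin.zero j *P perm K (VecF.removeAt H' i) (remove A j))
    step : ∀ j → when (A j) (H Fin.zero j *P perm (suc K) H' (remove A j))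
                 ≋ (r · oneP) *P (c *P when (A j) (H Fin.zero j *P perm K (VecF.removeAt H' i) (remove A j)))
    step j with A j in avail
    ... | false = ≋-sym (≋-trans (*-congˡ (r · oneP) (zeroʳ c)) (zeroʳ (r · oneP)))
    ... | true  = begin
      H Fin.zero j *P perm (suc K) H' (remove A j)
        ≈⟨ *-congˡ (H Fin.zero j) (perm-constant-row K H' (remove A j) i c r row (count-remove-+ A j avail r e)) ⟩
      H Fin.zero j *P ((r · oneP) *P (c *P perm K (VecF.removeAt H' i) (remove A j)))
        ≈⟨ *-left-comm (H Fin.zero j) (r · oneP) _ ⟩
      (r · oneP) *P (H Fin.zero j *P (c *P perm K (VecF.removeAt H' i) (remove A j)))
        ≈⟨ *-congˡ (r · oneP) (*-left-comm (H Fin.zero j) c _) ⟩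
      (r · oneP) *P (c *P (H Fin.zero j *P perm K (VecF.removeAt H' i) (remove A j))) ∎

dropLast : ∀ {K M} {X : Set} → (Fin K → Fin (suc M) → X) → Fin K → Fin M → X
dropLast H r = VecF.init (H r)

≟-inject₁ : ∀ {M} (a b : Fin M) → ⌊ inject₁ a Fin.≟ inject₁ b ⌋ ≡ ⌊ a Fin.≟ b ⌋
≟-inject₁ a b with a Fin.≟ b
... | yes refl = isYes-true (inject₁ a Fin.≟ inject₁ a) refl
... | no a≢b   = isYes-false (inject₁ a Fin.≟ inject₁ b) (a≢b ∘ FinP.inject₁-injective)

remove-init : ∀ {M} (A : Fin (suc M) → Bool) (j x : Fin M) → remove A (inject₁ j) (inject₁ x) ≡ remove (VecF.init A) j x
remove-init A j x = cong (λ b → A (inject₁ x) ∧ not b) (≟-inject₁ x j)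

remove-last-init : ∀ {M} (A : Fin (suc M) → Bool) (x : Fin M) → remove A (fromℕ M) (inject₁ x) ≡ VecF.init A x
remove-last-init A x = trans (cong (λ b → A (inject₁ x) ∧ not b) (isYes-false (inject₁ x Fin.≟ fromℕ _) (FinP.fromℕ≢inject₁ ∘ sym)))
                             (BoolP.∧-identityʳ _)

remove-keeps-last : ∀ {M} (A : Fin (suc M) → Bool) (j : Fin M) → remove A (inject₁ j) (fromℕ M) ≡ A (fromℕ M)
remove-keeps-last A j = trans (cong (λ b → A (fromℕ _) ∧ not b) (isYes-false (fromℕ _ Fin.≟ inject₁ j) FinP.fromℕ≢inject₁))
                              (BoolP.∧-identityʳ _)

module _ {N : ℕ} where
  open PolyAlgebra N

  perm-unavailable-last : ∀ K {M} (G : Fin K → Fin (suc M) → Poly N) (A : Fin (suc M) → Bool) →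
    A (fromℕ M) ≡ false → perm K G A ≋ perm K (dropLast G) (VecF.init A)
  perm-unavailable-last zero    G A e = ≋-refl
  perm-unavailable-last (suc K) {M} G A e = begin
    perm (suc K) G A
      ≈⟨ sum-init-last (λ j → when (A j) (G Fin.zero j *P perm K G' (remove A j))) ⟩
    ∑[ j < M ] when (A (inject₁ j)) (G Fin.zero (inject₁ j) *P perm K G' (remove A (inject₁ j)))
      +P when (A (fromℕ M)) (G Fin.zero (fromℕ M) *P perm K G' (remove A (fromℕ M)))
      ≈⟨ +-cong (sum-cong-≋ column) (≡⇒≋ (cong (λ b → when b (G Fin.zero (fromℕ M) *P perm K G' (remove A (fromℕ M)))) e)) ⟩
    perm (suc K) (dropLast G) (VecF.init A) +P zeroP
      ≈⟨ +-identityʳ _ ⟩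
    perm (suc K) (dropLast G) (VecF.init A) ∎
    where
    open SetoidReasoning setoid
    G' = G ∘ Fin.suc
    column : ∀ j → when (A (inject₁ j)) (G Fin.zero (inject₁ j) *P perm K G' (remove A (inject₁ j)))
                   ≋ when (A (inject₁ j)) (G Fin.zero (inject₁ j) *P perm K (dropLast G') (remove (VecF.init A) j))
    column j = when-cong (A (inject₁ j)) (*-congˡ (G Fin.zero (inject₁ j))
      (≋-trans (perm-unavailable-last K G' (remove A (inject₁ j)) (trans (remove-keeps-last A j) e))
               (perm-cong K (λ _ _ → ≋-refl) (remove-init A j))))

  ∑-when-swap : ∀ {K M} (a : Fin M → Bool) (g : Fin M → Poly N) (R : Fin K → Fin M → Poly N) →
    ∑[ j < M ] when (a j) (g j *P ∑[ i < K ] R i j) ≋ ∑[ i < K ] ∑[ j < M ] when (a j) (g j *P R i j)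
  ∑-when-swap {K} {M} a g R = ≋-trans
    (sum-cong-≋ λ j → ≋-trans (when-cong (a j) (*-distribˡ-sum (g j) (λ i → R i j))) (when-∑ (a j) λ i → g j *P R i j))
    (∑-comm (λ j i → when (a j) (g j *P R i j)))

  ∑-when-factor : ∀ {K M} (a : Fin M → Bool) (g : Fin M → Poly N) (h : Fin K → Poly N) (R : Fin K → Fin M → Poly N) →
    ∑[ j < M ] when (a j) (g j *P ∑[ i < K ] (h i *P R i j)) ≋ ∑[ i < K ] (h i *P ∑[ j < M ] when (a j) (g j *P R i j))
  ∑-when-factor {K} {M} a g h R = begin
    ∑[ j < M ] when (a j) (g j *P ∑[ i < K ] (h i *P R i j))
      ≈⟨ ∑-when-swap a g (λ i j → h i *P R i j) ⟩
    ∑[ i < K ] ∑[ j < M ] when (a j) (g j *P (h i *P R i j))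
      ≈⟨ sum-cong-≋ (λ i → sum-cong-≋ λ j → ≋-trans (when-cong (a j) (*-left-comm (g j) (h i) (R i j))) (when-* (a j) (h i) _)) ⟩
    ∑[ i < K ] ∑[ j < M ] (h i *P when (a j) (g j *P R i j))
      ≈⟨ sum-cong-≋ (λ i → *-distribˡ-sum (h i) (λ j → when (a j) (g j *P R i j))) ⟨
    ∑[ i < K ] (h i *P ∑[ j < M ] when (a j) (g j *P R i j)) ∎
    where open SetoidReasoning setoid

  first-row-in-last : ∀ K {M} (H : Fin (suc K) → Fin (suc M) → Poly N) (A : Fin (suc M) → Bool) → A (fromℕ M) ≡ true →
    when (A (fromℕ M)) (H Fin.zero (fromℕ M) *P perm K (H ∘ Fin.suc) (remove A (fromℕ M)))
      ≋ H Fin.zero (fromℕ M) *P perm K (dropLast (H ∘ Fin.suc)) (VecF.init A)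
  first-row-in-last K {M} H A avail =
    ≋-trans (≡⇒≋ (cong (λ b → when b (H Fin.zero last *P perm K (H ∘ Fin.suc) (remove A last))) avail))
      (*-congˡ (H Fin.zero last) (≋-trans (perm-unavailable-last K (H ∘ Fin.suc) (remove A last) removed)
                                          (perm-cong K (λ _ _ → ≋-refl) (remove-last-init A))))
    where
    last = fromℕ M
    removed : remove A last last ≡ false
    removed = trans (cong (λ b → A last ∧ not b) (isYes-true (last Fin.≟ last) refl)) (BoolP.∧-zeroʳ (A last))

  -- Expansion along the last column: either no row uses it, or exactly one
  -- row i does and the other rows are placed in the remaining columns.
  perm-last-column : ∀ K {M} (H : Fin (suc K) → Fin (suc M) → Poly N) (A : Fin (suc M) → Bool) → A (fromℕ M) ≡ true →
    perm (suc K) H A ≋ perm (suc K) (dropLast H) (VecF.init A)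
                       +P ∑[ i < suc K ] (H i (fromℕ M) *P perm K (dropLast (VecF.removeAt H i)) (VecF.init A))
  perm-last-column zero {M} H A avail = begin
    perm 1 H A
      ≈⟨ sum-init-last (λ j → when (A j) (H Fin.zero j *P oneP)) ⟩
    perm 1 (dropLast H) A° +P when (A (fromℕ M)) (H Fin.zero (fromℕ M) *P oneP)
      ≈⟨ +-cong (≋-refl {p = perm 1 (dropLast H) A°}) (≋-trans (first-row-in-last zero H A avail) (≋-sym (+-identityʳ _))) ⟩
    perm 1 (dropLast H) A° +P (H Fin.zero (fromℕ M) *P oneP +P zeroP) ∎
    where
    open SetoidReasoning setoid
    A° = VecF.init A
  perm-last-column (suc K) {M} H A avail = begin
    perm (suc (suc K)) H A
      ≈⟨ sum-init-last (λ j → when (A j) (H Fin.zero j *P perm (suc K) H' (remove A j))) ⟩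
    ∑[ j < M ] when (A° j) (H Fin.zero (inject₁ j) *P perm (suc K) H' (remove A (inject₁ j)))
      +P when (A last) (H Fin.zero last *P perm (suc K) H' (remove A last))
      ≈⟨ +-cong (sum-cong-≋ split) (first-row-in-last (suc K) H A avail) ⟩
    ∑[ j < M ] (when (A° j) (H Fin.zero (inject₁ j) *P perm (suc K) (dropLast H') (remove A° j))
                +P when (A° j) (H Fin.zero (inject₁ j) *P ∑[ i < suc K ] (H' i last *P R i j)))
      +P W
      ≈⟨ +-cong (∑-distrib-+ first second) (≋-refl {p = W}) ⟩
    (perm (suc (suc K)) (dropLast H) A° +P ∑[ j < M ] when (A° j) (H Fin.zero (inject₁ j) *P ∑[ i < suc K ] (H' i last *P R i j)))
      +P W
      ≈⟨ +-cong (+-cong (≋-refl {p = perm (suc (suc K)) (dropLast H) A°})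
                        (∑-when-factor A° (λ j → H Fin.zero (inject₁ j)) (λ i → H' i last) R))
                (≋-refl {p = W}) ⟩
    (perm (suc (suc K)) (dropLast H) A° +P Z) +P W
      ≈⟨ +-assoc (perm (suc (suc K)) (dropLast H) A°) Z W ⟩
    perm (suc (suc K)) (dropLast H) A° +P (Z +P W)
      ≈⟨ +-cong (≋-refl {p = perm (suc (suc K)) (dropLast H) A°}) (+-comm Z W) ⟩
    perm (suc (suc K)) (dropLast H) A° +P (W +P Z) ∎
    where
    open SetoidReasoning setoid
    H' = H ∘ Fin.suc
    last = fromℕ M
    A° = VecF.init A
    R : Fin (suc K) → Fin M → Poly N
    R i j = perm K (dropLast (VecF.removeAt H' i)) (remove A° j)
    first second : Fin M → Poly N
    first j = when (A° j) (H Fin.zero (inject₁ j) *P perm (suc K) (dropLast H') (remove A° j))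
    second j = when (A° j) (H Fin.zero (inject₁ j) *P ∑[ i < suc K ] (H' i last *P R i j))
    W = H Fin.zero last *P perm (suc K) (dropLast H') A°
    Z = ∑[ i < suc K ] (H' i last *P perm (suc K) (dropLast (VecF.removeAt H (Fin.suc i))) A°)
    split : ∀ j → when (A° j) (H Fin.zero (inject₁ j) *P perm (suc K) H' (remove A (inject₁ j)))
                  ≋ when (A° j) (H Fin.zero (inject₁ j) *P perm (suc K) (dropLast H') (remove A° j))
                    +P when (A° j) (H Fin.zero (inject₁ j) *P ∑[ i < suc K ] (H' i last *P R i j))
    split j = ≋-trans (when-cong (A° j) (≋-trans (*-congˡ (H Fin.zero (inject₁ j)) expanded) (distribˡ (H Fin.zero (inject₁ j)) _ _)))
                      (when-+ (A° j) (H Fin.zero (inject₁ j) *P perm (suc K) (dropLast H') (remove A° j))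
                                     (H Fin.zero (inject₁ j) *P ∑[ i < suc K ] (H' i last *P R i j)))
      where
      expanded : perm (suc K) H' (remove A (inject₁ j))
                 ≋ perm (suc K) (dropLast H') (remove A° j) +P ∑[ i < suc K ] (H' i last *P R i j)
      expanded = ≋-trans (perm-last-column K H' (remove A (inject₁ j)) (trans (remove-keeps-last A j) avail))
        (+-cong (perm-cong (suc K) {H = dropLast H'} (λ _ _ → ≋-refl) (remove-init A j))
                (sum-cong-≋ λ i → *-congˡ (H' i last) (perm-cong K {H = dropLast (VecF.removeAt H' i)} (λ _ _ → ≋-refl) (remove-init A j))))

  replaceRow : ∀ {K M} → (Fin K → Fin M → Poly N) → Fin K → (Fin M → Poly N) → Fin K → Fin M → Poly N
  replaceRow H i v = VecF.updateAt H i (λ _ → v)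

  module _ (d : Derivation N) where
    open Derivation d

    D-∑ : ∀ {M} (f : Fin M → Poly N) → D (∑[ j < M ] f j) ≋ ∑[ j < M ] D (f j)
    D-∑ {zero}  f = D-zero
    D-∑ {suc M} f = ≋-trans (D-+ (f Fin.zero) _) (+-cong (≋-refl {p = D (f Fin.zero)}) (D-∑ (f ∘ Fin.suc)))

    D-when : (b : Bool) (p : Poly N) → D (when b p) ≋ when b (D p)
    D-when true  p = ≋-refl
    D-when false p = D-zero

    perm-derivation : ∀ K {M} (H : Fin K → Fin M → Poly N) (A : Fin M → Bool) →
      D (perm K H A) ≋ ∑[ i < K ] perm K (replaceRow H i (λ j → D (H i j))) A
    perm-derivation zero    H A = D-one
    perm-derivation (suc K) {M} H A = begin
      D (∑[ j < M ] when (A j) (H Fin.zero j *P I j))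
        ≈⟨ D-∑ (λ j → when (A j) (H Fin.zero j *P I j)) ⟩
      ∑[ j < M ] D (when (A j) (H Fin.zero j *P I j))
        ≈⟨ sum-cong-≋ (λ j → ≋-trans (D-when (A j) _) (≋-trans (when-cong (A j) (D-* (H Fin.zero j) (I j))) (when-+ (A j) _ _))) ⟩
      ∑[ j < M ] (when (A j) (D (H Fin.zero j) *P I j) +P when (A j) (H Fin.zero j *P D (I j)))
        ≈⟨ ∑-distrib-+ (λ j → when (A j) (D (H Fin.zero j) *P I j)) (λ j → when (A j) (H Fin.zero j *P D (I j))) ⟩
      ∑[ j < M ] when (A j) (D (H Fin.zero j) *P I j) +P ∑[ j < M ] when (A j) (H Fin.zero j *P D (I j))
        ≈⟨ +-cong (≋-refl {p = ∑[ j < M ] when (A j) (D (H Fin.zero j) *P I j)})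
                  (≋-trans (sum-cong-≋ λ j → when-cong (A j) (*-congˡ (H Fin.zero j) (perm-derivation K H' (remove A j))))
                           (∑-when-swap A (H Fin.zero) J)) ⟩
      ∑[ j < M ] when (A j) (D (H Fin.zero j) *P I j) +P ∑[ i < K ] ∑[ j < M ] when (A j) (H Fin.zero j *P J i j) ∎
      where
      open SetoidReasoning setoid
      H' = H ∘ Fin.suc
      I : Fin M → Poly N
      I j = perm K H' (remove A j)
      J : Fin K → Fin M → Poly N
      J i j = perm K (replaceRow H' i (λ j' → D (H' i j'))) (remove A j)

  replaceRow-cong : ∀ {K M} (H : Fin K → Fin M → Poly N) (i : Fin K) {v v' : Fin M → Poly N} →
    (∀ j → v j ≋ v' j) → ∀ r j → replaceRow H i v r j ≋ replaceRow H i v' r j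
  replaceRow-cong H i {v} {v'} e r j with r Fin.≟ i
  ... | yes refl = ≋-trans (≡⇒≋ (cong (λ row → row j) (VecFP.updateAt-updates r H)))
                   (≋-trans (e j) (≡⇒≋ (cong (λ row → row j) (sym (VecFP.updateAt-updates r H)))))
  ... | no r≢i   = ≡⇒≋ (trans (cong (λ row → row j) (VecFP.updateAt-minimal r i H r≢i))
                              (cong (λ row → row j) (sym (VecFP.updateAt-minimal r i H r≢i))))

  removeAt-replaceRow : ∀ {K M} (H : Fin (suc K) → Fin M → Poly N) (i : Fin (suc K)) (v : Fin M → Poly N) →
    ∀ x → VecF.removeAt (replaceRow H i v) i x ≡ VecF.removeAt H i x
  removeAt-replaceRow H i v x = VecFP.updateAt-minimal (punchIn i x) i H (FinP.punchInᵢ≢i i x)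

-- The permanent of Defs is a partial permanent: per H sums over the
-- injective maps v : Fin m → Fin m (encoded as vectors of columns), and
-- perm m H (all columns available) sums over the same maps row by row.

T-ext : {a b : Bool} → (T a → T b) → (T b → T a) → a ≡ b
T-ext {false} {false} _ _ = refl
T-ext {false} {true}  _ g = ⊥-elim (g tt)
T-ext {true}  {false} f _ = ⊥-elim (f tt)
T-ext {true}  {true}  _ _ = refl

allB-tabulate⁺ : ∀ {k} {X : Set} (p : X → Bool) (g : Fin k → X) → (∀ i → T (p (g i))) → T (allB p (List.tabulate g))
allB-tabulate⁺ {zero}  p g h = tt
allB-tabulate⁺ {suc k} p g h = Equivalence.from BoolP.T-∧ (h Fin.zero , allB-tabulate⁺ p (g ∘ Fin.suc) (h ∘ Fin.suc))

allB-tabulate⁻ : ∀ {k} {X : Set} (p : X → Bool) (g : Fin k → X) → T (allB p (List.tabulate g)) → ∀ i → T (p (g i))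
allB-tabulate⁻ {suc k} p g t Fin.zero    = proj₁ (Equivalence.to BoolP.T-∧ t)
allB-tabulate⁻ {suc k} p g t (Fin.suc i) = allB-tabulate⁻ p (g ∘ Fin.suc) (proj₂ (Equivalence.to BoolP.T-∧ t)) i

module _ {k M : ℕ} where

  isInjective⁻ : (v : Vec (Fin M) k) → T (isInjective v) → Injective _≡_ _≡_ (lookup v)
  isInjective⁻ v t {r} {s} e with r Fin.≟ s | allB-tabulate⁻ _ id (allB-tabulate⁻ _ id t r) s
  ... | yes r≡s | _ = r≡s
  ... | no _    | h rewrite isYes-true (lookup v r Fin.≟ lookup v s) e = ⊥-elim h

  isInjective⁺ : (v : Vec (Fin M) k) → Injective _≡_ _≡_ (lookup v) → T (isInjective v)
  isInjective⁺ v inj = allB-tabulate⁺ _ id λ r → allB-tabulate⁺ _ id λ s → entry r s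
    where
    entry : ∀ r s → T (⌊ r Fin.≟ s ⌋ ∨ not ⌊ lookup v r Fin.≟ lookup v s ⌋)
    entry r s with r Fin.≟ s
    ... | yes _   = tt
    ... | no r≢s rewrite isYes-false (lookup v r Fin.≟ lookup v s) (r≢s ∘ inj) = tt

  admissible : (Fin M → Bool) → Vec (Fin M) k → Bool
  admissible A v = isInjective v ∧ allB (λ r → A (lookup v r)) (allFin k)

  Admissible : (Fin M → Bool) → Vec (Fin M) k → Set
  Admissible A v = Injective _≡_ _≡_ (lookup v) × (∀ r → T (A (lookup v r)))

  admissible⁻ : (A : Fin M → Bool) (v : Vec (Fin M) k) → T (admissible A v) → Admissible A v
  admissible⁻ A v t with Equivalence.to BoolP.T-∧ t
  ... | inj , avail = isInjective⁻ v inj , allB-tabulate⁻ _ id avail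

  admissible⁺ : (A : Fin M → Bool) (v : Vec (Fin M) k) → Admissible A v → T (admissible A v)
  admissible⁺ A v (inj , avail) = Equivalence.from BoolP.T-∧ (isInjective⁺ v inj , allB-tabulate⁺ _ id avail)

admissible-cons : ∀ {k M} (A : Fin M → Bool) (f : Fin M) (v : Vec (Fin M) k) →
  admissible A (f ∷ v) ≡ A f ∧ admissible (remove A f) v
admissible-cons A f v = T-ext to from
  where
  to : T (admissible A (f ∷ v)) → T (A f ∧ admissible (remove A f) v)
  to t with admissible⁻ A (f ∷ v) t
  ... | inj , avail = Equivalence.from BoolP.T-∧ (avail Fin.zero , admissible⁺ (remove A f) v
        ( (λ e → FinP.suc-injective (inj e))
        , λ r → Equivalence.from BoolP.T-∧ (avail (Fin.suc r) ,
                  subst T (sym (cong not (isYes-false (lookup v r Fin.≟ f) λ e → zero≢suc (inj (sym e))))) tt)))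
    where
    zero≢suc : ∀ {r} → Fin.zero ≡ Fin.suc r → ⊥
    zero≢suc ()
  from : T (A f ∧ admissible (remove A f) v) → T (admissible A (f ∷ v))
  from t with Equivalence.to BoolP.T-∧ t
  ... | avail-f , rest with admissible⁻ (remove A f) v rest
  ...   | inj , avail = admissible⁺ A (f ∷ v) (inj′ , avail′)
    where
    fresh : ∀ r → lookup v r ≡ f → ⊥
    fresh r e = subst (λ b → T (not b)) (isYes-true (lookup v r Fin.≟ f) e) (proj₂ (Equivalence.to BoolP.T-∧ (avail r)))
    inj′ : Injective _≡_ _≡_ (lookup (f ∷ v))
    inj′ {Fin.zero}  {Fin.zero}  e = refl
    inj′ {Fin.zero}  {Fin.suc s} e = ⊥-elim (fresh s (sym e))
    inj′ {Fin.suc r} {Fin.zero}  e = ⊥-elim (fresh r e)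
    inj′ {Fin.suc r} {Fin.suc s} e = cong Fin.suc (inj e)
    avail′ : ∀ r → T (A (lookup (f ∷ v) r))
    avail′ Fin.zero    = avail-f
    avail′ (Fin.suc r) = proj₁ (Equivalence.to BoolP.T-∧ (avail r))

module _ {N : ℕ} where
  open PolyAlgebra N

  prodRows : ∀ {k M} → (Fin k → Fin M → Poly N) → Vec (Fin M) k → Poly N
  prodRows {k} G v = prodP (map (λ r → G r (lookup v r)) (allFin k))

  prodRows-cons : ∀ {k M} (G : Fin (suc k) → Fin M → Poly N) (f : Fin M) (v : Vec (Fin M) k) →
    prodRows G (f ∷ v) ≡ G Fin.zero f *P prodRows (G ∘ Fin.suc) v
  prodRows-cons G f v = cong (λ l → G Fin.zero f *P prodP l)
    (trans (ListP.map-tabulate Fin.suc (λ r → G r (lookup (f ∷ v) r)))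
           (sym (ListP.map-tabulate id (λ r → G (Fin.suc r) (lookup v r)))))

  placements : ∀ k {M} (G : Fin k → Fin M → Poly N) (A : Fin M → Bool) →
    sumP (map (λ v → when (admissible A v) (prodRows G v)) (allMaps k M)) ≋ perm k G A
  placements zero    G A = +-identityʳ oneP
  placements (suc k) {M} G A = begin
    sumP (map term (concatMap (λ f → map (f ∷_) (allMaps k M)) (allFin M)))
      ≈⟨ sumP-concatMap term (λ f → map (f ∷_) (allMaps k M)) (allFin M) ⟩
    sumP (map (λ f → sumP (map term (map (f ∷_) (allMaps k M)))) (allFin M))
      ≡⟨ sumP-allFin (λ f → sumP (map term (map (f ∷_) (allMaps k M)))) ⟩
    ∑[ f < M ] sumP (map term (map (f ∷_) (allMaps k M)))
      ≈⟨ sum-cong-≋ first-column ⟩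
    perm (suc k) G A ∎
    where
    open SetoidReasoning setoid
    G' = G ∘ Fin.suc
    term : Vec (Fin M) (suc k) → Poly N
    term v = when (admissible A v) (prodRows G v)
    first-column : ∀ f → sumP (map term (map (f ∷_) (allMaps k M))) ≋ when (A f) (G Fin.zero f *P perm k G' (remove A f))
    first-column f = begin
      sumP (map term (map (f ∷_) (allMaps k M)))
        ≡⟨ cong sumP (ListP.map-∘ (allMaps k M)) ⟨
      sumP (map (λ v → term (f ∷ v)) (allMaps k M))
        ≈⟨ sumP-cong split (allMaps k M) ⟩
      sumP (map (λ v → when (A f) (G Fin.zero f *P when (admissible (remove A f) v) (prodRows G' v))) (allMaps k M))
        ≈⟨ sumP-when (A f) _ (allMaps k M) ⟩
      when (A f) (sumP (map (λ v → G Fin.zero f *P when (admissible (remove A f) v) (prodRows G' v)) (allMaps k M)))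
        ≈⟨ when-cong (A f) (≋-trans (sumP-* (G Fin.zero f) _ (allMaps k M)) (*-congˡ (G Fin.zero f) (placements k G' (remove A f)))) ⟩
      when (A f) (G Fin.zero f *P perm k G' (remove A f)) ∎
      where
      split : ∀ v → term (f ∷ v) ≋ when (A f) (G Fin.zero f *P when (admissible (remove A f) v) (prodRows G' v))
      split v = ≋-trans (≡⇒≋ (trans (cong₂ when (admissible-cons A f v) (prodRows-cons G f v))
                                    (sym (when-∧ (A f) _ _))))
                        (when-cong (A f) (when-* (admissible (remove A f) v) (G Fin.zero f) (prodRows G' v)))

  per≋perm : ∀ m (H : Fin m → Fin m → Poly N) → per H ≋ perm m H everything
  per≋perm m H = ≋-trans (sumP-filter (λ v → T? (isInjective v)) (prodRows H) (allMaps m m))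
    (≋-trans (≡⇒≋ (cong sumP (ListP.map-cong (λ v → cong (λ b → when b (prodRows H v)) (all-available v)) (allMaps m m))))
             (placements m H everything))
    where
    all-available : (v : Vec (Fin m) m) → isInjective v ≡ admissible everything v
    all-available v = sym (trans (cong (isInjective v ∧_) (trivial (allFin m))) (BoolP.∧-identityʳ _))
      where
      trivial : (l : List (Fin m)) → allB (λ _ → true) l ≡ true
      trivial []      = refl
      trivial (_ ∷ l) = trivial l

count-filter : ∀ {n} {X : Set} (p : X → Bool) (g : Fin n → X) →
  length (filter (λ x → T? (p x)) (List.tabulate g)) ≡ count (p ∘ g)
count-filter {zero}  p g = refl
count-filter {suc n} p g with p (g Fin.zero)
... | true  = cong suc (count-filter p (g ∘ Fin.suc))
... | false = count-filter p (g ∘ Fin.suc)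

count-init-last : ∀ {m} (c : Fin (suc m) → Bool) → count c ≡ count (VecF.init c) ℕ.+ (if c (fromℕ m) then 1 else 0)
count-init-last {zero}  c = ℕP.+-identityʳ _
count-init-last {suc m} c = trans (cong ((if c Fin.zero then 1 else 0) ℕ.+_) (count-init-last (c ∘ Fin.suc)))
                                  (sym (ℕP.+-assoc (if c Fin.zero then 1 else 0) _ _))

count-complement : ∀ {n} (c : Fin n → Bool) → count c ℕ.+ count (not ∘ c) ≡ n
count-complement {zero}  c = refl
count-complement {suc n} c with c Fin.zero
... | true  = cong suc (count-complement (c ∘ Fin.suc))
... | false = trans (ℕP.+-suc (count (c ∘ Fin.suc)) _) (cong suc (count-complement (c ∘ Fin.suc)))

threshold : ∀ {n} (c : Fin n → Bool) → (∀ i i' → toℕ i ℕ.≤ toℕ i' → c i' Bool.≤ c i) →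
  ∀ i → c i ≡ (toℕ i ℕ.<ᵇ count c)
threshold {suc n} c decreasing i with c Fin.zero in c₀
... | false = trans (all-false i)
                (sym (trans (cong (toℕ i ℕ.<ᵇ_) (count-none (c ∘ Fin.suc) (all-false ∘ Fin.suc))) (nothing-below (toℕ i))))
  where
  all-false : ∀ j → c j ≡ false
  all-false j with c j | subst (c j Bool.≤_) c₀ (decreasing Fin.zero j ℕ.z≤n)
  ... | false | _  = refl
  ... | true  | ()
  count-none : ∀ {n} (d : Fin n → Bool) → (∀ j → d j ≡ false) → count d ≡ 0
  count-none {zero}  d e = refl
  count-none {suc n} d e rewrite e Fin.zero = count-none (d ∘ Fin.suc) (e ∘ Fin.suc)
  nothing-below : ∀ x → (x ℕ.<ᵇ 0) ≡ false
  nothing-below zero    = refl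
  nothing-below (suc x) = refl
... | true with i
...   | Fin.zero   = c₀
...   | Fin.suc i′ = threshold (c ∘ Fin.suc) (λ j j' le → decreasing (Fin.suc j) (Fin.suc j') (ℕ.s≤s le)) i′

module _ {N : ℕ} where
  open PolyAlgebra N

  constP-suc : (n : ℕ) → constP {N} (+ suc n) ≋ oneP +P constP (+ n)
  constP-suc n = mk≋ λ m → coefficient ⌊ unitMono ≟M m ⌋
    where
    coefficient : (b : Bool) → (if b then + suc n else + 0) ℤ.+ + 0
                               ≡ (if b then + 1 else + 0) ℤ.+ ((if b then + n else + 0) ℤ.+ + 0)
    coefficient true  = refl
    coefficient false = refl

  constP-· : (n : ℕ) (p : Poly N) → constP (+ n) *P p ≋ n · p
  constP-· zero    p = ≋-trans (*-cong (null-term refl unitMono) (≋-refl {p = p})) ≋-refl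
  constP-· (suc n) p = ≋-trans (*-cong (constP-suc n) (≋-refl {p = p}))
    (≋-trans (*-distribʳ p oneP (constP (+ n))) (+-cong (*-identityˡ p) (constP-· n p)))

  ∑-split : ∀ {M} (a : Fin M → Bool) (p y : Poly N) (Q : Fin M → Poly N) →
    ∑[ i < M ] (if a i then y *P Q i else p) ≋ count (not ∘ a) · p +P y *P ∑[ i < M ] when (a i) (Q i)
  ∑-split {M} a p y Q = begin
    ∑[ i < M ] (if a i then y *P Q i else p)
      ≈⟨ sum-cong-≋ (λ i → by-cases (a i) (Q i)) ⟩
    ∑[ i < M ] (when (not (a i)) p +P y *P when (a i) (Q i))
      ≈⟨ ∑-distrib-+ (λ i → when (not (a i)) p) (λ i → y *P when (a i) (Q i)) ⟩
    ∑[ i < M ] when (not (a i)) p +P ∑[ i < M ] (y *P when (a i) (Q i))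
      ≈⟨ +-cong (∑-when-constant (not ∘ a) p) (≋-sym (*-distribˡ-sum y λ i → when (a i) (Q i))) ⟩
    count (not ∘ a) · p +P y *P ∑[ i < M ] when (a i) (Q i) ∎
    where
    open SetoidReasoning setoid
    by-cases : ∀ b q → (if b then y *P q else p) ≋ when (not b) p +P y *P when b q
    by-cases true  q = ≋-refl
    by-cases false q = ≋-sym (≋-trans (+-cong (≋-refl {p = p}) (zeroʳ y)) (+-identityʳ p))

module Ferrers {m : ℕ} (A : Fin (suc m) → Fin (suc m) → Bool) (ferrers : IsFerrers A) where

  row-zero : ∀ i → A i (fromℕ m) ≡ false → ∀ j → A i j ≡ false
  row-zero i e j with A i j | subst (A i j Bool.≤_) e (proj₂ ferrers i j (fromℕ m) (FinP.≤fromℕ j))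
  ... | false | _  = refl
  ... | true  | ()

  row-one : ∀ i j → A i j ≡ true → A i (fromℕ m) ≡ true
  row-one i j e with A i (fromℕ m) | subst (Bool._≤ A i (fromℕ m)) e (proj₂ ferrers i j (fromℕ m) (FinP.≤fromℕ j))
  ... | true  | _  = refl
  ... | false | ()

  -- If a_nn = 0, then k - 1
  -- of them lie in rows 1..n-1, and the entry of the last column in row i < n
  -- is 1 exactly when i < n - k (columns decrease).
  module LastColumn (k : ℕ) (k≡zeros : k ≡ zerosInColumn A (fromℕ m)) (corner : A (fromℕ m) (fromℕ m) ≡ false) where

    column : Fin (suc m) → Bool
    column i = A i (fromℕ m)

    k≡count : k ≡ count (not ∘ column)
    k≡count = trans k≡zeros (count-filter (not ∘ column) id)

    k≡suc : k ≡ suc (count (not ∘ VecF.init column))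
    k≡suc = trans k≡count (trans (count-init-last (not ∘ column))
              (trans (cong (λ b → count (not ∘ VecF.init column) ℕ.+ (if not b then 1 else 0)) corner)
                     (ℕP.+-comm _ 1)))

    ones-initial : ∀ i → does (toℕ (inject₁ i) ℕ.<? (suc m ℕ.∸ k)) ≡ column (inject₁ i)
    ones-initial i = sym (trans (threshold column (λ i i' le → proj₁ ferrers i i' (fromℕ m) le) (inject₁ i))
                                (cong (toℕ (inject₁ i) ℕ.<ᵇ_) ones))
      where
      ones : count column ≡ suc m ℕ.∸ k
      ones = sym (trans (cong (ℕ._∸ k) (sym (count-complement column)))
                        (trans (cong (λ z → count column ℕ.+ z ℕ.∸ k) (sym k≡count)) (ℕP.m+n∸n≡m (count column) k)))

punchIn-last : ∀ m (x : Fin m) → punchIn (fromℕ m) x ≡ inject₁ x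
punchIn-last (suc m) Fin.zero    = refl
punchIn-last (suc m) (Fin.suc x) = cong Fin.suc (punchIn-last m x)

<ᵇ-true : ∀ {a b} → a ℕ.< b → (a ℕ.<ᵇ b) ≡ true
<ᵇ-true a<b = Equivalence.to BoolP.T-≡ (ℕP.<⇒<ᵇ a<b)

module _ {N : ℕ} where
  open PolyAlgebra N

  deleteRow-perm : ∀ {m M} → (Fin m → Fin M → Poly N) → Fin m → Poly N
  deleteRow-perm {suc K} G i = perm K (VecF.removeAt G i) everything

  constant-row : ∀ {m} (G : Fin m → Fin m → Poly N) (i : Fin m) (c : Poly N) →
    (∀ j → G i j ≋ c) → perm m G everything ≋ c *P deleteRow-perm G i
  constant-row {suc K} G i c row =
    ≋-trans (perm-constant-row K G everything i c 1 row (count-all (suc K)))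
            (≋-trans (*-cong (+-identityʳ oneP) (≋-refl {p = c *P deleteRow-perm G i})) (*-identityˡ _))

  zero-row : ∀ {m} (G : Fin m → Fin m → Poly N) (i : Fin m) → (∀ j → G i j ≋ zeroP) → perm m G everything ≋ zeroP
  zero-row G i row = constant-row G i zeroP row

  ones-row : ∀ {m} (G : Fin m → Fin m → Poly N) (i : Fin m) →
    perm m (replaceRow G i (λ _ → oneP)) everything ≋ deleteRow-perm G i
  ones-row {suc K} G i = ≋-trans (constant-row (replaceRow G i (λ _ → oneP)) i oneP
                                   (λ j → ≡⇒≋ (cong (λ row → row j) (VecFP.updateAt-updates i G))))
                                 (≋-trans (*-identityˡ _)
                                          (perm-cong K (λ x j → ≡⇒≋ (cong (λ row → row j) (removeAt-replaceRow G i _ x))) λ _ → refl))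

  last-column : ∀ {m} (H : Fin m → Fin (suc m) → Poly N) →
    perm m H everything ≋ perm m (dropLast H) everything +P ∑[ i < m ] (H i (fromℕ m) *P deleteRow-perm (dropLast H) i)
  last-column {zero}  H = ≋-sym (+-identityʳ oneP)
  last-column {suc K} H = perm-last-column K H everything refl

module Expansion {m : ℕ} (A : Fin (suc m) → Fin (suc m) → Bool) (ferrers : IsFerrers A)
  (corner : A (fromℕ m) (fromℕ m) ≡ false) (k : ℕ) (k≡zeros : k ≡ zerosInColumn A (fromℕ m)) where

  open PolyAlgebra (suc m)
  open SetoidReasoning setoid
  open Ferrers A ferrers
  open LastColumn k k≡zeros corner

  x y : Poly (suc m)
  x = xv (fromℕ m)
  y = yv (fromℕ m)

  B° : Fin m → Fin m → Poly (suc m)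
  B° = B inject₁ (deleteLast A)

  Bᵗ : Fin m → Fin (suc m) → Poly (suc m)
  Bᵗ r = B id A (inject₁ r)

  P : Poly (suc m)
  P = perm m B° everything

  a : Fin m → Bool
  a = VecF.init column

  Q : Fin m → Poly (suc m)
  Q i = perm m (replaceRow B° i (λ _ → oneP)) everything

  -- The last row of A is zero, so the last row of B(A) is constantly x_n.
  per-last-row : perm (suc m) (B id A) everything ≋ x *P perm m Bᵗ everything
  per-last-row = ≋-trans (constant-row (B id A) (fromℕ m) x
                            λ j → ≡⇒≋ (cong (λ b → if b then yv j else x) (row-zero (fromℕ m) corner j)))
                         (*-congˡ x (perm-cong m (λ r j → ≡⇒≋ (cong (λ i → B id A i j) (punchIn-last m r))) λ _ → refl))

  -- Expanding along the last column: the row i < n using it contributes P if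
  -- a_i = 0 (row i of B° is then constantly x_i) and y_n Q_i if a_i = 1.
  per-last-column : perm m Bᵗ everything ≋ P +P ∑[ i < m ] (if a i then y *P Q i else P)
  per-last-column = ≋-trans (last-column Bᵗ) (+-cong (≋-refl {p = P}) (sum-cong-≋ row-term))
    where
    row-term : ∀ i → Bᵗ i (fromℕ m) *P deleteRow-perm B° i ≋ (if a i then y *P Q i else P)
    row-term i with a i in aᵢ
    ... | true  = *-congˡ y (≋-sym (ones-row B° i))
    ... | false = ≋-sym (constant-row B° i (xv (inject₁ i))
                          λ j → ≡⇒≋ (cong (λ b → if b then yv (inject₁ j) else xv (inject₁ i)) (row-zero (inject₁ i) aᵢ (inject₁ j))))

  ∂ᴰ : Derivation (suc m)
  ∂ᴰ = ∂-derivation (suc m) k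

  S : Poly (suc m)
  S = ∑[ i < m ] when (a i) (Q i)

  -- ∂ acts on an entry of row i of B° as the constant a_i: an entry y_j has
  -- j < n - 1 and occurs only when a_i = 1, while x_i is differentiated
  -- exactly when i < n - k, that is when a_i = 1.
  ∂-entry : ∀ i j → Derivation.D ∂ᴰ (B° i j) ≋ when (a i) oneP
  ∂-entry i j = ≋-trans (≡⇒≋ (∂-derivation-apply (suc m) k (B° i j))) (by-entry (A (inject₁ i) (inject₁ j)) refl)
    where
    by-entry : ∀ b → A (inject₁ i) (inject₁ j) ≡ b → ∂op (suc m) k (B° i j) ≋ when (a i) oneP
    by-entry true e = ≋-trans (≡⇒≋ (cong (λ b → ∂op (suc m) k (if b then yv (inject₁ j) else xv (inject₁ i))) e))
      (≋-trans (∂op-yv (suc m) k (inject₁ j))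
               (≡⇒≋ (cong (λ b → when b oneP) (trans (<ᵇ-true (subst (ℕ._< m) (sym (FinP.toℕ-inject₁ j)) (FinP.toℕ<n j)))
                                                     (sym (row-one (inject₁ i) (inject₁ j) e))))))
    by-entry false e = ≋-trans (≡⇒≋ (cong (λ b → ∂op (suc m) k (if b then yv (inject₁ j) else xv (inject₁ i))) e))
      (≋-trans (∂op-xv (suc m) k (inject₁ i)) (≡⇒≋ (cong (λ b → when b oneP) (ones-initial i))))

  ∂P : Derivation.D ∂ᴰ P ≋ S
  ∂P = ≋-trans (perm-derivation ∂ᴰ m B° everything) (sum-cong-≋ row)
    where
    constant : ∀ i b → perm m (replaceRow B° i (λ _ → when b oneP)) everything ≋ when b (Q i)
    constant i true  = ≋-refl
    constant i false = zero-row (replaceRow B° i (λ _ → zeroP)) i (λ j → ≡⇒≋ (cong (λ row → row j) (VecFP.updateAt-updates i B°)))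
    row : ∀ i → perm m (replaceRow B° i (λ j → Derivation.D ∂ᴰ (B° i j))) everything ≋ when (a i) (Q i)
    row i = ≋-trans (perm-cong m (replaceRow-cong B° i (∂-entry i)) (λ _ → refl)) (constant i (a i))

  ∂-per-B° : ∂op (suc m) k (per B°) ≋ S
  ∂-per-B° = ≋-trans (≡⇒≋ (sym (∂-derivation-apply (suc m) k (per B°))))
                     (≋-trans (Derivation.D-cong ∂ᴰ (per≋perm m B°)) ∂P)

  per-B : per (B id A) ≋ x *P (k · P +P y *P S)
  per-B = begin
    per (B id A)                                   ≈⟨ per≋perm (suc m) (B id A) ⟩
    perm (suc m) (B id A) everything               ≈⟨ per-last-row ⟩
    x *P perm m Bᵗ everything                      ≈⟨ *-congˡ x per-last-column ⟩
    x *P (P +P ∑[ i < m ] (if a i then y *P Q i else P))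
      ≈⟨ *-congˡ x (+-cong (≋-refl {p = P}) (∑-split a P y Q)) ⟩
    x *P (P +P (count (not ∘ a) · P +P y *P S))    ≈⟨ *-congˡ x (≋-sym (+-assoc P _ (y *P S))) ⟩
    x *P (suc (count (not ∘ a)) · P +P y *P S)     ≡⟨ cong (λ n → x *P (n · P +P y *P S)) (sym k≡suc) ⟩
    x *P (k · P +P y *P S)                         ∎

-- The theorem.  The hypothesis k ≥ 1 is implied by a_nn = 0 and not needed.

lemma3p3 : (m : ℕ) → (A : Fin (suc m) → Fin (suc m) → Bool) → IsFerrers A
    → A (fromℕ m) (fromℕ m) ≡ false
    → (k : ℕ) → k ≡ zerosInColumn A (fromℕ m) → 1 ≤ k
    → per (B (λ i → i) A)
    ≈P constP (+ k) *P xv (fromℕ m) *P per (B inject₁ (deleteLast A))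
    +P xv (fromℕ m) *P yv (fromℕ m) *P ∂op (suc m) k (per (B inject₁ (deleteLast A)))
lemma3p3 m A ferrers corner k k≡zeros _ = coeffEq (begin
  per (B id A)                                       ≈⟨ per-B ⟩
  x *P (k · P +P y *P S)                             ≈⟨ distribˡ x (k · P) (y *P S) ⟩
  x *P (k · P) +P x *P (y *P S)                      ≈⟨ +-cong scale (≋-sym (*-assoc x y S)) ⟩
  constP (+ k) *P x *P P +P x *P y *P S
    ≈⟨ +-cong (*-congˡ (constP (+ k) *P x) (≋-sym (per≋perm m B°))) (*-congˡ (x *P y) (≋-sym ∂-per-B°)) ⟩
  constP (+ k) *P x *P per B° +P x *P y *P ∂op (suc m) k (per B°) ∎)
  where
  open Expansion A ferrers corner k k≡zeros
  open PolyAlgebra (suc m)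
  open SetoidReasoning setoid
  scale : x *P (k · P) ≋ constP (+ k) *P x *P P
  scale = ≋-trans (×-comm-* k x P) (≋-trans (≋-sym (constP-· k (x *P P))) (≋-sym (*-assoc (constP (+ k)) x P)))
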